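{- Let $A,B,C\in\mathbb{Z}$ with $A\ge1$, $f(n)=A\binom{n}{4}+B\binom{n}{3}+C\binom{n}{2}+n$, $m\in\mathbb{Z}$, and for $q\in\mathbb{N}$ let $\mathcal{M}_m(q)$ be the number of $(n_1,\dots,n_s)\in\{1,\dots,q\}^s$ with $f(n_1)+\dots+f(n_s)\equiv m\pmod q$. Then for any prime $p\ge11$ and integers $k\ge2$, $s\ge17$, we have $\mathcal{M}_m(p^k)\ge p^{(k-1)(s-1)}$. -}

module Defs where

open import Data.Nat as ℕ using (ℕ; zero; suc)
open import Data.Nat.Combinatorics using (_C_)
open import Data.Nat.Divisibility using (_∣?_)
open import Data.Integer as ℤ using (ℤ; +_)
open import Data.Integer.Divisibility using (_∣_)
open import Data.List using (List; []; _∷_; map; concatMap; filter; length)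
open import Data.List.Base using (upTo)
open import Data.Vec using (Vec; []; _∷_)
open import Relation.Nullary using (Dec)

f : ℤ → ℤ → ℤ → ℕ → ℤ
f a b c n = a ℤ.* (+ (n C 4)) ℤ.+ b ℤ.* (+ (n C 3)) ℤ.+ c ℤ.* (+ (n C 2)) ℤ.+ (+ n)

range1 : ℕ → List ℕ
range1 q = map suc (upTo q)

tuples : (q s : ℕ) → List (Vec ℕ s)
tuples q zero = [] ∷ []
tuples q (suc s) = concatMap (λ n → map (n ∷_) (tuples q s)) (range1 q)

fsum : ℤ → ℤ → ℤ → {s : ℕ} → Vec ℕ s → ℤ
fsum a b c [] = + 0
fsum a b c (n ∷ ns) = f a b c n ℤ.+ fsum a b c ns

-- decidability of divisibility in ℤ (a ∣ b is defined as ∣a∣ ∣ ∣b∣ in ℕ)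
_∣ℤ?_ : (a b : ℤ) → Dec (a ∣ b)
a ∣ℤ? b = ℤ.∣ a ∣ ∣? ℤ.∣ b ∣

M : (a b c : ℤ) (s : ℕ) (m : ℤ) (q : ℕ) → ℕ
M a b c s m q =
  length (filter (λ v → (+ q) ∣ℤ? (fsum a b c v ℤ.- m)) (tuples q s))

-- Write 24 f = F, an integer quartic with F(1) = 24.  For each y, the r < p with f(r + 1) ≡ y
-- (mod p) are roots of the quartic F(x + 1) − 24y, which is nonzero mod p since its values at 0
-- and −1 differ by 24; so the value set V of f on 1, …, p has at least p/4 elements.  Choose
-- a₀ ∈ {0, 1, 2, 3} with F′(a₀) ≢ 0 (mod p).  Iterating the Cauchy–Davenport inequality, the
-- sumset f(a₀) + V + ⋯ + V with s − 1 ≥ 16 copies of V is all of ℤ/p.  So every m is congruent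
-- to f(a₀) + f(n₂) + ⋯ + f(nₛ) mod p; Hensel's lemma at the nonsingular point a₀ solves
-- f(n₁) ≡ m − f(n₂) − ⋯ − f(nₛ) mod p^k, and since f is periodic mod p, each of n₂, …, nₛ can be
-- replaced by any of the p^(k−1) numbers in 1, …, p^k congruent to it mod p.

module Submission where

open import Data.Integer as ℤ using (ℤ)
open import Data.Nat using (ℕ; NonZero; _<_)
open import Data.Nat.Primality using (Prime)
open import Defs

module FiniteSums where

  open import Data.Bool using (Bool; true; false; _∨_; _∧_)
  open import Data.Bool.Properties using (T-≡)
  open import Data.Empty using (⊥-elim)
  open import Data.Nat using (ℕ; zero; suc; _+_; _*_; _≤_; _<_; _≡ᵇ_; z≤n; s≤s; z<s; s<s)
  open import Data.Nat.Properties
  open import Data.Nat.Tactic.RingSolver using (solve-∀)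
  open import Data.Product using (∃; _×_; _,_)
  open import Data.Sum using (_⊎_; inj₁; inj₂)
  open import Function using (_∘_)
  open import Function.Bundles using (Equivalence)
  open import Relation.Binary.PropositionalEquality
  open import Relation.Nullary using (¬_)

  ∑ : ℕ → (ℕ → ℕ) → ℕ
  ∑ zero    g = 0
  ∑ (suc N) g = g 0 + ∑ N (g ∘ suc)

  ∑-cong : ∀ N {g h} → (∀ i → i < N → g i ≡ h i) → ∑ N g ≡ ∑ N h
  ∑-cong zero    e = refl
  ∑-cong (suc N) e = cong₂ _+_ (e 0 z<s) (∑-cong N (λ i i<N → e (suc i) (s<s i<N)))

  ∑-mono-≤ : ∀ N {g h} → (∀ i → i < N → g i ≤ h i) → ∑ N g ≤ ∑ N h
  ∑-mono-≤ zero    e = z≤n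
  ∑-mono-≤ (suc N) e = +-mono-≤ (e 0 z<s) (∑-mono-≤ N (λ i i<N → e (suc i) (s<s i<N)))

  ∑-mono-< : ∀ N {g h} → (∀ i → i < N → g i ≤ h i) → ∀ j → j < N → g j < h j → ∑ N g < ∑ N h
  ∑-mono-< (suc N) e zero    _         gj<hj = +-mono-<-≤ gj<hj (∑-mono-≤ N (λ i i<N → e (suc i) (s<s i<N)))
  ∑-mono-< (suc N) e (suc j) (s≤s j<N) gj<hj =
    +-mono-≤-< (e 0 z<s) (∑-mono-< N (λ i i<N → e (suc i) (s<s i<N)) j j<N gj<hj)

  ∑-distrib-+ : ∀ N g h → ∑ N (λ i → g i + h i) ≡ ∑ N g + ∑ N h
  ∑-distrib-+ zero    g h = refl
  ∑-distrib-+ (suc N) g h =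
    trans (cong (g 0 + h 0 +_) (∑-distrib-+ N (g ∘ suc) (h ∘ suc))) (interchange (g 0) (h 0) _ _)
    where
    interchange : ∀ a b c d → a + b + (c + d) ≡ (a + c) + (b + d)
    interchange = solve-∀

  ∑-const : ∀ N c → ∑ N (λ _ → c) ≡ N * c
  ∑-const zero    c = refl
  ∑-const (suc N) c = cong (c +_) (∑-const N c)

  ∑-zero : ∀ N → ∑ N (λ _ → 0) ≡ 0
  ∑-zero N = trans (∑-const N 0) (*-zeroʳ N)

  ∑-*ˡ : ∀ N c g → ∑ N (λ i → c * g i) ≡ c * ∑ N g
  ∑-*ˡ zero    c g = sym (*-zeroʳ c)
  ∑-*ˡ (suc N) c g = trans (cong (c * g 0 +_) (∑-*ˡ N c (g ∘ suc))) (sym (*-distribˡ-+ c (g 0) _))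

  ∑-swap : ∀ M N (h : ℕ → ℕ → ℕ) → ∑ M (λ i → ∑ N (h i)) ≡ ∑ N (λ j → ∑ M (λ i → h i j))
  ∑-swap zero    N h = sym (∑-zero N)
  ∑-swap (suc M) N h = trans (cong (∑ N (h 0) +_) (∑-swap M N (h ∘ suc)))
                            (sym (∑-distrib-+ N (h 0) (λ j → ∑ M (λ i → h (suc i) j))))

  ∑-split : ∀ M N g → ∑ (M + N) g ≡ ∑ M g + ∑ N (λ i → g (M + i))
  ∑-split zero    N g = refl
  ∑-split (suc M) N g = trans (cong (g 0 +_) (∑-split M N (g ∘ suc))) (sym (+-assoc (g 0) _ _))

  ∑-last : ∀ N g → ∑ (suc N) g ≡ ∑ N g + g N
  ∑-last zero    g = +-identityʳ (g 0)
  ∑-last (suc N) g = trans (cong (g 0 +_) (∑-last N (g ∘ suc))) (sym (+-assoc (g 0) _ _))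

  term≤∑ : ∀ N g {r} → r < N → g r ≤ ∑ N g
  term≤∑ (suc N) g {zero}  _         = m≤m+n (g 0) _
  term≤∑ (suc N) g {suc r} (s≤s r<N) = ≤-trans (term≤∑ N (g ∘ suc) r<N) (m≤n+m _ (g 0))

  ∑-subsample : ∀ Q p g {r} → r < p → ∑ Q (λ t → g (t * p + r)) ≤ ∑ (Q * p) g
  ∑-subsample zero    p g r<p = z≤n
  ∑-subsample (suc Q) p g {r} r<p = begin
    g r + ∑ Q (λ t → g (suc t * p + r))      ≡⟨ cong (g r +_) (∑-cong Q (λ t _ → cong g (+-assoc p (t * p) r))) ⟩
    g r + ∑ Q (λ t → g (p + (t * p + r)))    ≤⟨ +-mono-≤ (term≤∑ p g r<p) (∑-subsample Q p (λ i → g (p + i)) r<p) ⟩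
    ∑ p g + ∑ (Q * p) (λ i → g (p + i))      ≡⟨ ∑-split p (Q * p) g ⟨
    ∑ (suc Q * p) g                          ∎
    where open ≤-Reasoning

  𝟙 : Bool → ℕ
  𝟙 true  = 1
  𝟙 false = 0

  count : ℕ → (ℕ → Bool) → ℕ
  count N A = ∑ N (𝟙 ∘ A)

  count-cong : ∀ N {A B} → (∀ i → i < N → A i ≡ B i) → count N A ≡ count N B
  count-cong N e = ∑-cong N (λ i i<N → cong 𝟙 (e i i<N))

  𝟙-mono : ∀ {a b} → (a ≡ true → b ≡ true) → 𝟙 a ≤ 𝟙 b
  𝟙-mono {false} _ = z≤n
  𝟙-mono {true}  h rewrite h refl = ≤-refl

  count-mono : ∀ N {A B} → (∀ i → i < N → A i ≡ true → B i ≡ true) → count N A ≤ count N B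
  count-mono N h = ∑-mono-≤ N (λ i i<N → 𝟙-mono (h i i<N))

  count-mono-< : ∀ N {A B} → (∀ i → i < N → A i ≡ true → B i ≡ true) →
                 ∀ j → j < N → A j ≡ false → B j ≡ true → count N A < count N B
  count-mono-< N {A} {B} h j j<N Aj Bj = ∑-mono-< N (λ i i<N → 𝟙-mono (h i i<N)) j j<N 𝟙Aj<𝟙Bj
    where
    𝟙Aj<𝟙Bj : 𝟙 (A j) < 𝟙 (B j)
    𝟙Aj<𝟙Bj rewrite Aj | Bj = z<s

  count-all : ∀ N {A} → (∀ i → i < N → A i ≡ true) → count N A ≡ N
  count-all N h = trans (count-cong N h) (trans (∑-const N 1) (*-identityʳ N))

  count-none : ∀ N {A} → (∀ i → i < N → A i ≡ false) → count N A ≡ 0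
  count-none N h = trans (count-cong N h) (∑-zero N)

  count-∨-∧ : ∀ N A B → count N (λ i → A i ∨ B i) + count N (λ i → A i ∧ B i) ≡ count N A + count N B
  count-∨-∧ N A B = begin
    count N (λ i → A i ∨ B i) + count N (λ i → A i ∧ B i)   ≡⟨ ∑-distrib-+ N _ _ ⟨
    ∑ N (λ i → 𝟙 (A i ∨ B i) + 𝟙 (A i ∧ B i))             ≡⟨ ∑-cong N (λ i _ → 𝟙-∨-∧ (A i) (B i)) ⟩
    ∑ N (λ i → 𝟙 (A i) + 𝟙 (B i))                         ≡⟨ ∑-distrib-+ N _ _ ⟩
    count N A + count N B                                  ∎
    where
    open ≡-Reasoning
    𝟙-∨-∧ : ∀ a b → 𝟙 (a ∨ b) + 𝟙 (a ∧ b) ≡ 𝟙 a + 𝟙 b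
    𝟙-∨-∧ true  true  = refl
    𝟙-∨-∧ true  false = refl
    𝟙-∨-∧ false b     = +-identityʳ (𝟙 b)

  count-∨ : ∀ N A B → count N (λ i → A i ∨ B i) ≤ count N A + count N B
  count-∨ N A B = ≤-trans (m≤m+n _ _) (≤-reflexive (count-∨-∧ N A B))

  count-≡ᵇ : ∀ N {c} → c < N → count N (_≡ᵇ c) ≡ 1
  count-≡ᵇ (suc N) {zero}  _         = cong suc (∑-zero N)
  count-≡ᵇ (suc N) {suc c} (s≤s c<N) = count-≡ᵇ N c<N

  count-witness : ∀ N A → 0 < count N A → ∃ λ i → i < N × A i ≡ true
  count-witness (suc N) A h with A 0 in A0
  ... | true  = 0 , z<s , A0
  ... | false with count-witness N (A ∘ suc) h
  ...   | i , i<N , Ai = suc i , s<s i<N , Ai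

  count-member : ∀ N {A i} → i < N → A i ≡ true → 0 < count N A
  count-member N {A} i<N Ai = ≤-trans (≤-reflexive (cong 𝟙 (sym Ai))) (term≤∑ N (𝟙 ∘ A) i<N)

  count≡0⊎member : ∀ N A → count N A ≡ 0 ⊎ ∃ λ i → i < N × A i ≡ true
  count≡0⊎member N A with count N A in |A|
  ... | zero  = inj₁ refl
  ... | suc _ = inj₂ (count-witness N A (subst (0 <_) (sym |A|) z<s))

  count-zero : ∀ N A → count N A ≡ 0 → ∀ i → i < N → A i ≡ false
  count-zero N A c≡0 i i<N with A i in Ai
  ... | false = refl
  ... | true  = ⊥-elim (<-irrefl (sym c≡0) (count-member N i<N Ai))

  anyBelow : ℕ → (ℕ → Bool) → Bool
  anyBelow zero    A = false
  anyBelow (suc N) A = A 0 ∨ anyBelow N (A ∘ suc)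

  anyBelow-intro : ∀ N A {i} → i < N → A i ≡ true → anyBelow N A ≡ true
  anyBelow-intro (suc N) A {zero}  _         Ai rewrite Ai = refl
  anyBelow-intro (suc N) A {suc i} (s≤s i<N) Ai with A 0
  ... | true  = refl
  ... | false = anyBelow-intro N (A ∘ suc) i<N Ai

  anyBelow-elim : ∀ N A → anyBelow N A ≡ true → ∃ λ i → i < N × A i ≡ true
  anyBelow-elim (suc N) A h with A 0 in A0
  ... | true  = 0 , z<s , A0
  ... | false with anyBelow-elim N (A ∘ suc) h
  ...   | i , i<N , Ai = suc i , s<s i<N , Ai

  count-rotate : ∀ N A (next : ℕ → ℕ) → (∀ x → x < N → next x ≡ suc x) → next N ≡ 0 →
                 count (suc N) (A ∘ next) ≡ count (suc N) A
  count-rotate N A next next≡suc nextN≡0 = begin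
    count (suc N) (A ∘ next)             ≡⟨ ∑-last N (𝟙 ∘ A ∘ next) ⟩
    count N (A ∘ next) + 𝟙 (A (next N))  ≡⟨ cong₂ _+_ (count-cong N (λ x x<N → cong A (next≡suc x x<N)))
                                                      (cong (𝟙 ∘ A) nextN≡0) ⟩
    count N (A ∘ suc) + 𝟙 (A 0)          ≡⟨ +-comm _ (𝟙 (A 0)) ⟩
    count (suc N) A                      ∎
    where open ≡-Reasoning

  ≡ᵇ-true⇒≡ : ∀ {m n} → (m ≡ᵇ n) ≡ true → m ≡ n
  ≡ᵇ-true⇒≡ {m} {n} e = ≡ᵇ⇒≡ m n (Equivalence.from T-≡ e)

  ≡⇒≡ᵇ-true : ∀ {m n} → m ≡ n → (m ≡ᵇ n) ≡ true
  ≡⇒≡ᵇ-true {m} {n} e = Equivalence.to T-≡ (≡⇒≡ᵇ m n e)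

  ∨-true : ∀ a {b} → a ∨ b ≡ true → a ≡ true ⊎ b ≡ true
  ∨-true true  _ = inj₁ refl
  ∨-true false h = inj₂ h

  ¬true⇒false : ∀ {b} → ¬ b ≡ true → b ≡ false
  ¬true⇒false {false} _ = refl
  ¬true⇒false {true}  h = ⊥-elim (h refl)

  ¬false⇒true : ∀ {b} → ¬ b ≡ false → b ≡ true
  ¬false⇒true {true}  _ = refl
  ¬false⇒true {false} h = ⊥-elim (h refl)

  count-full : ∀ N A → N ≤ count N A → ∀ i → i < N → A i ≡ true
  count-full N A N≤count i i<N = ¬false⇒true λ Ai≡false →
    <-irrefl refl (<-≤-trans (subst (count N A <_) (count-all N {λ _ → true} (λ _ _ → refl))
                                    (count-mono-< N (λ _ _ _ → refl) i i<N Ai≡false refl)) N≤count)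

module Congruence where

  open import Data.Integer using (ℤ; +_; _+_; _*_; _-_; -_)
  open import Data.Integer.Divisibility.Signed using (_∣_; divides; ∣m∣n⇒∣m+n; ∣m⇒∣-m; ∣m∣n⇒∣m-n; ∣n⇒∣m*n; ∣m⇒∣m*n)
  open import Data.Integer.Properties using (+-inverseʳ; +-identityʳ)
  open import Data.Integer.Tactic.RingSolver using (solve-∀)
  open import Data.Nat using (ℕ)
  open import Relation.Binary.Bundles using (Setoid)
  open import Relation.Binary.PropositionalEquality

  infix 4 _≡_mod_

  record _≡_mod_ (a b : ℤ) (n : ℕ) : Set where
    constructor modulo
    field ∣-diff : + n ∣ a - b
  open _≡_mod_ public

  module _ {n : ℕ} where

    mod-refl : ∀ {a} → a ≡ a mod n
    mod-refl {a} = modulo (divides (+ 0) (+-inverseʳ a))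

    mod-reflexive : ∀ {a b} → a ≡ b → a ≡ b mod n
    mod-reflexive refl = mod-refl

    mod-sym : ∀ {a b} → a ≡ b mod n → b ≡ a mod n
    mod-sym {a} {b} (modulo d) = modulo (subst (+ n ∣_) (neg a b) (∣m⇒∣-m d))
      where
      neg : ∀ a b → - (a - b) ≡ b - a
      neg = solve-∀

    mod-trans : ∀ {a b c} → a ≡ b mod n → b ≡ c mod n → a ≡ c mod n
    mod-trans {a} {b} {c} (modulo d) (modulo e) = modulo (subst (+ n ∣_) (telescope a b c) (∣m∣n⇒∣m+n d e))
      where
      telescope : ∀ a b c → (a - b) + (b - c) ≡ a - c
      telescope = solve-∀

    +-cong : ∀ {a b c d} → a ≡ b mod n → c ≡ d mod n → a + c ≡ b + d mod n
    +-cong {a} {b} {c} {d} (modulo x) (modulo y) = modulo (subst (+ n ∣_) (regroup a b c d) (∣m∣n⇒∣m+n x y))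
      where
      regroup : ∀ a b c d → (a - b) + (c - d) ≡ (a + c) - (b + d)
      regroup = solve-∀

    minus-cong : ∀ {a b c d} → a ≡ b mod n → c ≡ d mod n → a - c ≡ b - d mod n
    minus-cong {a} {b} {c} {d} (modulo x) (modulo y) = modulo (subst (+ n ∣_) (regroup a b c d) (∣m∣n⇒∣m-n x y))
      where
      regroup : ∀ a b c d → (a - b) - (c - d) ≡ (a - c) - (b - d)
      regroup = solve-∀

    *-congˡ : ∀ k {a b} → a ≡ b mod n → k * a ≡ k * b mod n
    *-congˡ k {a} {b} (modulo x) = modulo (subst (+ n ∣_) (distrib k a b) (∣n⇒∣m*n k x))
      where
      distrib : ∀ k a b → k * (a - b) ≡ k * a - k * b
      distrib = solve-∀

    *-congʳ : ∀ k {a b} → a ≡ b mod n → a * k ≡ b * k mod n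
    *-congʳ k {a} {b} (modulo x) = modulo (subst (+ n ∣_) (distrib k a b) (∣m⇒∣m*n k x))
      where
      distrib : ∀ k a b → (a - b) * k ≡ a * k - b * k
      distrib = solve-∀

    ∣⇒≡0 : ∀ {a} → + n ∣ a → a ≡ + 0 mod n
    ∣⇒≡0 {a} d = modulo (subst (+ n ∣_) (sym (+-identityʳ a)) d)

    ≡0⇒∣ : ∀ {a} → a ≡ + 0 mod n → + n ∣ a
    ≡0⇒∣ {a} (modulo d) = subst (+ n ∣_) (+-identityʳ a) d

  mod-setoid : ℕ → Setoid _ _
  mod-setoid n = record
    { Carrier       = ℤ
    ; _≈_           = λ a b → a ≡ b mod n
    ; isEquivalence = record { refl = mod-refl ; sym = mod-sym ; trans = mod-trans }
    }

  module ≡-mod-Reasoning (n : ℕ) where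
    open import Relation.Binary.Reasoning.Setoid (mod-setoid n) public

module Residues (p : ℕ) .⦃ p≢0 : NonZero p ⦄ where

  open import Data.Integer using (ℤ; +_; _+_; _*_; _-_; -_; ∣_∣; _%ℕ_; _/ℕ_)
  open import Data.Integer.DivMod using (n%ℕd<d; a≡a%ℕn+[a/ℕn]*n)
  open import Data.Integer.Divisibility.Signed using (divides; ∣⇒∣ᵤ)
  open import Data.Integer.Properties as ℤ using (m-n≡m⊖n; ⊖-≥)
  open import Data.Integer.Tactic.RingSolver using (solve-∀)
  open import Data.Nat as ℕ using (zero; suc; _<_; _≤_; z≤n)
  open import Data.Nat.DivMod using (m<n⇒m%n≡m)
  open import Data.Nat.Divisibility as ℕ using (>⇒∤)
  open import Data.Nat.Properties using (<⇒≢; ≤-total; ≤-antisym; m∸n≡0⇒m≤n; ≤-<-trans; m∸n≤m)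
  open import Data.Product using (∃; _×_; _,_)
  open import Data.Sum using (inj₁; inj₂)
  open import Relation.Binary.PropositionalEquality
  open import Relation.Nullary using (¬_; contradiction; Dec)
  open import Relation.Nullary.Decidable using (map′)

  open Congruence

  opaque
    res : ℤ → ℕ
    res z = z %ℕ p

    res<p : ∀ z → res z < p
    res<p z = n%ℕd<d z p

    res-≡mod : ∀ z → + res z ≡ z mod p
    res-≡mod z = modulo (divides (- (z /ℕ p)) (remainder (+ res z) (z /ℕ p) (a≡a%ℕn+[a/ℕn]*n z p)))
      where
      cancel : ∀ r d q → r - (r + d * q) ≡ - d * q
      cancel = solve-∀
      remainder : ∀ r d → z ≡ r + d * + p → r - z ≡ - d * + p
      remainder r d eq = trans (cong (λ t → r - t) eq) (cancel r d (+ p))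

    res-below : ∀ {x} → x < p → res (+ x) ≡ x
    res-below = m<n⇒m%n≡m

  ∣-below⇒≡0 : ∀ {n} → n < p → p ℕ.∣ n → n ≡ 0
  ∣-below⇒≡0 {zero}  _   _   = refl
  ∣-below⇒≡0 {suc n} n<p p∣n = contradiction p∣n (>⇒∤ n<p)

  ≡mod-≤⇒≡ : ∀ {x y} → y ≤ x → x < p → + x ≡ + y mod p → x ≡ y
  ≡mod-≤⇒≡ {x} {y} y≤x x<p (modulo p∣x-y) =
    ≤-antisym (m∸n≡0⇒m≤n (∣-below⇒≡0 (≤-<-trans (m∸n≤m x y) x<p) p∣x∸y)) y≤x
    where
    p∣x∸y : p ℕ.∣ x ℕ.∸ y
    p∣x∸y = subst (λ z → p ℕ.∣ ∣ z ∣) (trans (m-n≡m⊖n x y) (⊖-≥ y≤x)) (∣⇒∣ᵤ p∣x-y)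

  ≡mod⇒≡ : ∀ {x y} → x < p → y < p → + x ≡ + y mod p → x ≡ y
  ≡mod⇒≡ {x} {y} x<p y<p x≡y with ≤-total y x
  ... | inj₁ y≤x = ≡mod-≤⇒≡ y≤x x<p x≡y
  ... | inj₂ x≤y = sym (≡mod-≤⇒≡ x≤y y<p (mod-sym x≡y))

  res-cong : ∀ {a b} → a ≡ b mod p → res a ≡ res b
  res-cong {a} {b} a≡b = ≡mod⇒≡ (res<p a) (res<p b) (begin
    + res a  ≈⟨ res-≡mod a ⟩
    a        ≈⟨ a≡b ⟩
    b        ≈⟨ res-≡mod b ⟨
    + res b  ∎)
    where open ≡-mod-Reasoning p

  res-injective : ∀ {a b} → res a ≡ res b → a ≡ b mod p
  res-injective {a} {b} e = mod-trans (mod-sym (res-≡mod a)) (mod-trans (mod-reflexive (cong +_ e)) (res-≡mod b))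

  ≢0-below : ∀ {n} → 0 < n → n < p → ¬ + n ≡ + 0 mod p
  ≢0-below {n} 0<n n<p n≡0 = <⇒≢ 0<n (sym (≡mod⇒≡ n<p (≤-<-trans z≤n n<p) n≡0))

  res≡0⇒≡0 : ∀ {a} → res a ≡ 0 → a ≡ + 0 mod p
  res≡0⇒≡0 {a} e = mod-trans (mod-sym (res-≡mod a)) (mod-reflexive (cong +_ e))

  ≡0⇒res≡0 : ∀ {a} → a ≡ + 0 mod p → res a ≡ 0
  ≡0⇒res≡0 a≡0 = trans (res-cong a≡0) (res-below (≤-<-trans z≤n (res<p (+ 0))))

  ≡0? : ∀ a → Dec (a ≡ + 0 mod p)
  ≡0? a = map′ res≡0⇒≡0 ≡0⇒res≡0 (res a ℕ.≟ 0)

  ≡suc-below : ∀ z → ∃ λ i → i < p × z ≡ + suc i mod p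
  ≡suc-below z = res (z - + 1) , res<p (z - + 1) , (begin
    z                      ≡⟨ shift z ⟩
    z - + 1 + + 1          ≈⟨ +-cong (res-≡mod (z - + 1)) (mod-refl {a = + 1}) ⟨
    + res (z - + 1) + + 1  ≡⟨ ℤ.+-comm (+ res (z - + 1)) (+ 1) ⟩
    + suc (res (z - + 1))  ∎)
    where
    open ≡-mod-Reasoning p
    shift : ∀ z → z ≡ z - + 1 + + 1
    shift = solve-∀

module PrimeModulus (p : ℕ) (prime : Prime p) where

  open import Data.Nat.Primality using (prime⇒nonZero; euclidsLemma)
  open import Data.Empty using (⊥-elim)
  open import Data.Integer using (ℤ; +_; _+_; _*_; _-_; -_; ∣_∣)
  open import Data.Integer.Divisibility.Signed using (_∣_; divides; ∣⇒∣ᵤ; ∣ᵤ⇒∣; ∣-trans; *-cancelʳ-∣; *-monoˡ-∣)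
  open import Data.Integer.Properties using (abs-*; pos-+; pos-*; neg-distribˡ-*; *-identityʳ; *-assoc; *-comm; +-identityʳ)
  open import Data.Integer.Tactic.RingSolver using (solve-∀)
  open import Data.Nat as ℕ using (zero; suc; _<_; _^_; z<s)
  open import Data.Nat.Coprimality using (prime⇒coprime; coprime-Bézout)
  import Data.Nat.Divisibility as ℕ
  open import Data.Nat.GCD using (module Bézout)
  import Data.Nat.Properties as ℕ
  open import Data.Product using (∃; _×_; _,_)
  open import Data.Sum as Sum using (_⊎_; inj₁; inj₂; [_,_])
  open import Function using (_∘_)
  open import Relation.Binary.PropositionalEquality hiding ([_])
  open import Relation.Nullary using (¬_)

  open Congruence

  instance
    p≢0 : NonZero p
    p≢0 = prime⇒nonZero prime

  open Residues p

  euclid : ∀ {a b} → + p ∣ a * b → (+ p ∣ a) ⊎ (+ p ∣ b)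
  euclid {a} {b} p∣ab =
    Sum.map ∣ᵤ⇒∣ ∣ᵤ⇒∣ (euclidsLemma ∣ a ∣ ∣ b ∣ prime (subst (p ℕ.∣_) (abs-* a b) (∣⇒∣ᵤ p∣ab)))

  *≡0⇒≡0⊎≡0 : ∀ a b → a * b ≡ + 0 mod p → a ≡ + 0 mod p ⊎ b ≡ + 0 mod p
  *≡0⇒≡0⊎≡0 a b ab≡0 = Sum.map ∣⇒≡0 ∣⇒≡0 (euclid (≡0⇒∣ ab≡0))

  ≢0-* : ∀ {a b} → ¬ a ≡ + 0 mod p → ¬ b ≡ + 0 mod p → ¬ a * b ≡ + 0 mod p
  ≢0-* {a} {b} a≢0 b≢0 ab≡0 = [ a≢0 , b≢0 ] (*≡0⇒≡0⊎≡0 a b ab≡0)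

  pos-^-suc : ∀ j → + (p ^ suc j) ≡ + (p ^ j) * + p
  pos-^-suc j = trans (pos-* p (p ^ j)) (*-comm (+ p) (+ (p ^ j)))

  pos-1+*≡* : ∀ a b c d → 1 ℕ.+ a ℕ.* b ≡ c ℕ.* d → + 1 + + a * + b ≡ + c * + d
  pos-1+*≡* a b c d e =
    trans (cong (_+_ (+ 1)) (sym (pos-* a b))) (trans (sym (pos-+ 1 (a ℕ.* b))) (trans (cong +_ e) (pos-* c d)))

  inverse-below : ∀ {r} → 0 < r → r < p → ∃ λ w → w * + r ≡ + 1 mod p
  inverse-below {suc r} _ r<p with coprime-Bézout (prime⇒coprime prime r<p)
  ... | Bézout.+- x y eq = - + y , modulo (divides (- + x) (negated (+ y) (+ suc r) (+ x) (+ p) (pos-1+*≡* y (suc r) x p eq)))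
    where
    negated : ∀ y r x q → + 1 + y * r ≡ x * q → (- y) * r - + 1 ≡ (- x) * q
    negated y r x q e = trans (regroup y r) (trans (cong -_ e) (neg-distribˡ-* x q))
      where
      regroup : ∀ y r → (- y) * r - + 1 ≡ - (+ 1 + y * r)
      regroup = solve-∀
  ... | Bézout.-+ x y eq = + y , modulo (divides (+ x) (shifted (+ x) (+ p) (+ y) (+ suc r) (pos-1+*≡* x p y (suc r) eq)))
    where
    shifted : ∀ x q y r → + 1 + x * q ≡ y * r → y * r - + 1 ≡ x * q
    shifted x q y r e = trans (cong (_- + 1) (sym e)) (cancel x q)
      where
      cancel : ∀ x q → + 1 + x * q - + 1 ≡ x * q
      cancel = solve-∀

  inverse : ∀ {a} → ¬ a ≡ + 0 mod p → ∃ λ w → w * a ≡ + 1 mod p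
  inverse {a} a≢0 with res a in ra
  ... | zero  = ⊥-elim (a≢0 (res≡0⇒≡0 ra))
  ... | suc r with inverse-below z<s (subst (_< p) ra (res<p a))
  ...   | w , wr≡1 = w , mod-trans (*-congˡ w (mod-sym (subst (λ n → + n ≡ a mod p) ra (res-≡mod a)))) wr≡1

  *-distribˡ-minus : ∀ c a b → c * a - c * b ≡ c * (a - b)
  *-distribˡ-minus = solve-∀

  *-cancelˡ-mod : ∀ {c a b} → ¬ c ≡ + 0 mod p → c * a ≡ c * b mod p → a ≡ b mod p
  *-cancelˡ-mod {c} {a} {b} c≢0 (modulo p∣ca-cb) =
    [ ⊥-elim ∘ c≢0 , modulo ∘ ≡0⇒∣ ] (*≡0⇒≡0⊎≡0 c (a - b) (∣⇒≡0 (subst (+ p ∣_) (*-distribˡ-minus c a b) p∣ca-cb)))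

  ^-∣-cancelˡ : ∀ j {c x} → ¬ c ≡ + 0 mod p → + (p ^ j) ∣ c * x → + (p ^ j) ∣ x
  ^-∣-cancelˡ zero    {c} {x} _   _ = divides x (sym (*-identityʳ x))
  ^-∣-cancelˡ (suc j) {c} {x} c≢0 pʲ⁺¹∣cx with euclid (∣-trans (divides (+ (p ^ j)) (pos-^-suc j)) pʲ⁺¹∣cx)
  ... | inj₁ p∣c             = ⊥-elim (c≢0 (∣⇒≡0 p∣c))
  ... | inj₂ (divides y refl) = subst (_∣ y * + p) (sym (pos-^-suc j))
          (*-monoˡ-∣ (+ p) (^-∣-cancelˡ j c≢0 (*-cancelʳ-∣ (+ p) pʲp∣cyp)))
    where
    pʲp∣cyp : + (p ^ j) * + p ∣ c * y * + p
    pʲp∣cyp = subst₂ _∣_ (pos-^-suc j) (sym (*-assoc c y (+ p))) pʲ⁺¹∣cx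

  *-cancelˡ-mod-^ : ∀ j {c a b} → ¬ c ≡ + 0 mod p → c * a ≡ c * b mod p ^ j → a ≡ b mod p ^ j
  *-cancelˡ-mod-^ j {c} {a} {b} c≢0 (modulo pʲ∣ca-cb) =
    modulo (^-∣-cancelˡ j c≢0 (subst (+ (p ^ j) ∣_) (*-distribˡ-minus c a b) pʲ∣ca-cb))

  module Hensel (F F′ : ℤ → ℤ) (K : ℤ → ℤ → ℤ)
    (taylor : ∀ n h → F (n + h) ≡ F n + h * F′ n + h * h * K n h)
    (F′-resp : ∀ {x y} → x ≡ y mod p → F′ x ≡ F′ y mod p) where

    p^suc-multiple : ∀ j x → + (p ^ suc j) * x ≡ + 0 mod p
    p^suc-multiple j x = ∣⇒≡0 (divides (+ (p ^ j) * x) (trans (cong (_* x) (pos-* p (p ^ j))) (regroup (+ p) (+ (p ^ j)) x)))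
      where
      regroup : ∀ a b x → a * b * x ≡ b * x * a
      regroup = solve-∀

    newton-step : ∀ j {T n} → ¬ F′ n ≡ + 0 mod p → F n ≡ T mod p ^ suc j →
                  ∃ λ n′ → n′ ≡ n mod p × F n′ ≡ T mod p ^ suc (suc j)
    newton-step j {T} {n} F′n≢0 = lift (inverse F′n≢0)
      where
      P : ℤ
      P = + (p ^ suc j)
      lift : (∃ λ w → w * F′ n ≡ + 1 mod p) → F n ≡ T mod p ^ suc j →
             ∃ λ n′ → n′ ≡ n mod p × F n′ ≡ T mod p ^ suc (suc j)
      lift (w , w*F′n≡1) (modulo (divides E Fn-T≡E*P)) = n + P * u , n′≡n , modulo (divides Z/p Fn′-T≡Z/p*p²)
        where
        u Z : ℤ
        u = - (E * w)
        Z = E + u * F′ n + P * (u * u * K n (P * u))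

        Fn′-T≡P*Z : F (n + P * u) - T ≡ P * Z
        Fn′-T≡P*Z = begin
          F (n + P * u) - T                                           ≡⟨ cong (_- T) (taylor n (P * u)) ⟩
          F n + P * u * F′ n + P * u * (P * u) * K n (P * u) - T      ≡⟨ regroup (F n) T P u (F′ n) (K n (P * u)) ⟩
          (F n - T) + P * u * F′ n + P * u * (P * u) * K n (P * u)    ≡⟨ cong (λ t → t + P * u * F′ n + P * u * (P * u) * K n (P * u)) Fn-T≡E*P ⟩
          E * P + P * u * F′ n + P * u * (P * u) * K n (P * u)        ≡⟨ factor E P u (F′ n) (K n (P * u)) ⟩
          P * Z                                                       ∎
          where
          open ≡-Reasoning
          regroup : ∀ a T P u D k → a + P * u * D + P * u * (P * u) * k - T ≡ (a - T) + P * u * D + P * u * (P * u) * k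
          regroup = solve-∀
          factor : ∀ E P u D k → E * P + P * u * D + P * u * (P * u) * k ≡ P * (E + u * D + P * (u * u * k))
          factor = solve-∀

        Z≡0 : Z ≡ + 0 mod p
        Z≡0 = begin
          Z                                                 ≡⟨ regroup E w (F′ n) (P * (u * u * K n (P * u))) ⟩
          E - E * (w * F′ n) + P * (u * u * K n (P * u))    ≈⟨ +-cong (minus-cong (mod-refl {a = E}) (*-congˡ E w*F′n≡1))
                                                                      (p^suc-multiple j (u * u * K n (P * u))) ⟩
          E - E * + 1 + + 0                                 ≡⟨ cancel E ⟩
          + 0                                               ∎
          where
          open ≡-mod-Reasoning p
          regroup : ∀ E w D X → E + - (E * w) * D + X ≡ E - E * (w * D) + X
          regroup = solve-∀
          cancel : ∀ E → E - E * + 1 + + 0 ≡ + 0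
          cancel = solve-∀

        Z/p : ℤ
        Z/p = _∣_.quotient (≡0⇒∣ Z≡0)

        Fn′-T≡Z/p*p² : F (n + P * u) - T ≡ Z/p * + (p ^ suc (suc j))
        Fn′-T≡Z/p*p² = begin
          F (n + P * u) - T    ≡⟨ Fn′-T≡P*Z ⟩
          P * Z                ≡⟨ cong (P *_) (_∣_.equality (≡0⇒∣ Z≡0)) ⟩
          P * (Z/p * + p)      ≡⟨ regroup P Z/p (+ p) ⟩
          Z/p * (+ p * P)      ≡⟨ cong (Z/p *_) (pos-* p (p ^ suc j)) ⟨
          Z/p * + (p ^ suc (suc j)) ∎
          where
          open ≡-Reasoning
          regroup : ∀ P z q → P * (z * q) ≡ z * (q * P)
          regroup = solve-∀

        n′≡n : n + P * u ≡ n mod p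
        n′≡n = mod-trans (+-cong (mod-refl {a = n}) (p^suc-multiple j u)) (mod-reflexive (+-identityʳ n))

    hensel : ∀ j {T a} → F a ≡ T mod p → ¬ F′ a ≡ + 0 mod p → ∃ λ n → n ≡ a mod p × F n ≡ T mod p ^ suc j
    hensel zero    {a = a} Fa≡T _ = a , mod-refl , subst (λ q → F a ≡ _ mod q) (sym (ℕ.*-identityʳ p)) Fa≡T
    hensel (suc j) Fa≡T F′a≢0 =
      let (n , n≡a , Fn≡T)    = hensel j Fa≡T F′a≢0
          (n′ , n′≡n , Fn′≡T) = newton-step j (F′a≢0 ∘ mod-trans (F′-resp (mod-sym n≡a))) Fn≡T
      in  n′ , mod-trans n′≡n n≡a , Fn′≡T

module PolynomialFunctions where

  open import Data.Bool using (Bool; true; false; _∨_)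
  open import Data.Bool.Properties using (∨-zeroʳ)
  open import Data.Integer using (ℤ; +_; _+_; _*_; _-_; -_)
  open import Data.Integer.Divisibility.Signed using (_∣_; ∣m⇒∣m*n)
  open import Data.Integer.Tactic.RingSolver using (solve-∀)
  open import Data.Nat as ℕ using (ℕ; zero; suc; _≤_; _<_; _≡ᵇ_; z≤n)
  open import Data.Nat.Primality using (Prime)
  open import Data.Nat.Properties as ℕ using (≤-reflexive)
  open import Data.Product using (∃; _×_; _,_)
  open import Data.Sum using (inj₁; inj₂)
  open import Function using (_∘_)
  open import Relation.Binary.PropositionalEquality
  open import Relation.Nullary using (¬_)

  open Congruence
  open FiniteSums

  a≡b+c⇒a-b≡c : ∀ {a b c} → a ≡ b + c → a - b ≡ c
  a≡b+c⇒a-b≡c {b = b} {c} refl = cancel b c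
    where
    cancel : ∀ b c → b + c - b ≡ c
    cancel = solve-∀

  -- Polynomial functions of degree ≤ d, described through the factor theorem.
  Degree≤ : ℕ → (ℤ → ℤ) → Set
  Degree≤ zero    F = ∀ x y → F x ≡ F y
  Degree≤ (suc d) F = ∀ r → ∃ λ G → Degree≤ d G × (∀ x → F x ≡ F r + (x - r) * G x)

  Degree≤-resp-≗ : ∀ d {F G} → (∀ x → F x ≡ G x) → Degree≤ d F → Degree≤ d G
  Degree≤-resp-≗ zero    F≗G deg x y = trans (sym (F≗G x)) (trans (deg x y) (F≗G y))
  Degree≤-resp-≗ (suc d) {F} F≗G deg r =
    let (H , degH , F≡) = deg r
    in  H , degH , λ x → trans (sym (F≗G x)) (trans (F≡ x) (cong (_+ (x - r) * H x) (F≗G r)))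

  Degree≤-suc : ∀ d {F} → Degree≤ d F → Degree≤ (suc d) F
  Degree≤-suc zero    {F} deg r = (λ _ → + 0) , (λ _ _ → refl) , λ x → trans (deg x r) (sym (c+t*0≡c (F r) (x - r)))
    where
    c+t*0≡c : ∀ c t → c + t * + 0 ≡ c
    c+t*0≡c = solve-∀
  Degree≤-suc (suc d) deg r =
    let (G , degG , F≡) = deg r
    in  G , Degree≤-suc d degG , F≡

  Degree≤-const : ∀ d c → Degree≤ d (λ _ → c)
  Degree≤-const zero    c _ _ = refl
  Degree≤-const (suc d) c     = Degree≤-suc d (Degree≤-const d c)

  Degree≤-+-* : ∀ d {F G} → Degree≤ d F → Degree≤ d G → ∀ k → Degree≤ d (λ x → F x + k * G x)
  Degree≤-+-* zero    degF degG k x y = cong₂ (λ a b → a + k * b) (degF x y) (degG x y)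
  Degree≤-+-* (suc d) {F} {G} degF degG k r =
    let (F′ , degF′ , F≡) = degF r
        (G′ , degG′ , G≡) = degG r
    in  (λ x → F′ x + k * G′ x) , Degree≤-+-* d degF′ degG′ k ,
        λ x → trans (cong₂ (λ a b → a + k * b) (F≡ x) (G≡ x)) (regroup (F r) (G r) (x - r) (F′ x) (G′ x) k)
    where
    regroup : ∀ a b t a′ b′ k → (a + t * a′) + k * (b + t * b′) ≡ (a + k * b) + t * (a′ + k * b′)
    regroup = solve-∀

  Degree≤-horner : ∀ d c {F} → Degree≤ d F → Degree≤ (suc d) (λ x → c + x * F x)
  Degree≤-horner zero c {F} degF r =
    F , degF , λ x → trans (cong (λ t → c + x * t) (degF x r))
                           (trans (regroup c x r (F r)) (cong (λ t → c + r * F r + (x - r) * t) (degF r x)))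
    where
    regroup : ∀ c x r f → c + x * f ≡ c + r * f + (x - r) * f
    regroup = solve-∀
  Degree≤-horner (suc d) c {F} degF r =
    let (G , degG , F≡) = degF r
    in  (λ x → F x + r * G x) , Degree≤-+-* (suc d) degF (Degree≤-suc d degG) r ,
        λ x → trans (cong (λ t → c + x * t) (F≡ x))
                    (trans (regroup c x r (F r) (G x)) (cong (λ t → c + r * F r + (x - r) * (t + r * G x)) (sym (F≡ x))))
    where
    regroup : ∀ c x r a g → c + x * (a + (x - r) * g) ≡ c + r * a + (x - r) * ((a + (x - r) * g) + r * g)
    regroup = solve-∀

  Degree≤-shift : ∀ d {F} → Degree≤ d F → ∀ s → Degree≤ d (λ x → F (x + s))
  Degree≤-shift zero    deg s x y = deg (x + s) (y + s)
  Degree≤-shift (suc d) {F} deg s r =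
    let (G , degG , F≡) = deg (r + s)
    in  (λ x → G (x + s)) , Degree≤-shift d degG s ,
        λ x → trans (F≡ (x + s)) (cong (λ t → F (r + s) + t * G (x + s)) (cancel x r s))
    where
    cancel : ∀ x r s → (x + s) - (r + s) ≡ x - r
    cancel = solve-∀

  Degree≤-resp-mod : ∀ d {F} → Degree≤ d F → ∀ {n x y} → x ≡ y mod n → F x ≡ F y mod n
  Degree≤-resp-mod zero    deg {x = x} {y} _ = mod-reflexive (deg x y)
  Degree≤-resp-mod (suc d) {F} deg {n} {x} {y} (modulo n∣x-y) =
    let (G , _ , F≡) = deg y
    in  modulo (subst (+ n ∣_) (sym (a≡b+c⇒a-b≡c (F≡ x))) (∣m⇒∣m*n (G x) n∣x-y))

  module RootBound (p : ℕ) (prime : Prime p) where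

    open PrimeModulus p prime
    open Residues p

    roots : (ℤ → ℤ) → ℕ → Bool
    roots Q x = res (Q (+ x)) ≡ᵇ 0

    root⇒≡0 : ∀ Q x → roots Q x ≡ true → Q (+ x) ≡ + 0 mod p
    root⇒≡0 Q x = res≡0⇒≡0 ∘ ≡ᵇ-true⇒≡

    ≡0⇒root : ∀ Q x → Q (+ x) ≡ + 0 mod p → roots Q x ≡ true
    ≡0⇒root Q x = ≡⇒≡ᵇ-true ∘ ≡0⇒res≡0

    ≢0⇒non-root : ∀ Q x → ¬ Q (+ x) ≡ + 0 mod p → roots Q x ≡ false
    ≢0⇒non-root Q x Qx≢0 = ¬true⇒false (Qx≢0 ∘ root⇒≡0 Q x)

    root-bound : ∀ d Q → Degree≤ d Q → ∀ x₀ → ¬ Q x₀ ≡ + 0 mod p → count p (roots Q) ≤ d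
    root-bound zero    Q deg x₀ Qx₀≢0 =
      ≤-reflexive (count-none p (λ x _ → ≢0⇒non-root Q x (Qx₀≢0 ∘ mod-trans (mod-reflexive (deg x₀ (+ x))))))
    root-bound (suc d) Q deg x₀ Qx₀≢0 with count≡0⊎member p (roots Q)
    ... | inj₁ |roots|≡0 = subst (_≤ suc d) (sym |roots|≡0) z≤n
    ... | inj₂ (r₀ , r₀<p , r₀∈roots) =
      let (G , degG , Q≡) = deg (+ r₀) in through-root G degG Q≡ r₀<p (root⇒≡0 Q r₀ r₀∈roots)
      where
      through-root : ∀ {r₀} G → Degree≤ d G → (∀ x → Q x ≡ Q (+ r₀) + (x - + r₀) * G x) →
                     r₀ < p → Q (+ r₀) ≡ + 0 mod p → count p (roots Q) ≤ suc d
      through-root {r₀} G degG Q≡ r₀<p Qr₀≡0 = begin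
        count p (roots Q)                           ≤⟨ count-mono p split ⟩
        count p (λ x → (x ≡ᵇ r₀) ∨ roots G x)       ≤⟨ count-∨ p _ _ ⟩
        count p (_≡ᵇ r₀) ℕ.+ count p (roots G)      ≡⟨ cong (ℕ._+ _) (count-≡ᵇ p r₀<p) ⟩
        suc (count p (roots G))                     ≤⟨ ℕ.s≤s (root-bound d G degG x₀ Gx₀≢0) ⟩
        suc d                                       ∎
        where
        open ℕ.≤-Reasoning
        0+t*0≡0 : ∀ t → + 0 + t * + 0 ≡ + 0
        0+t*0≡0 = solve-∀
        Gx₀≢0 : ¬ G x₀ ≡ + 0 mod p
        Gx₀≢0 Gx₀≡0 = Qx₀≢0 (mod-trans (mod-reflexive (Q≡ x₀))
          (mod-trans (+-cong Qr₀≡0 (*-congˡ (x₀ - + r₀) Gx₀≡0)) (mod-reflexive (0+t*0≡0 (x₀ - + r₀)))))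
        factor : ∀ x → x < p → roots Q x ≡ true → (+ x - + r₀) * G (+ x) ≡ + 0 mod p
        factor x _ x∈roots =
          mod-trans (mod-reflexive (sym (a≡b+c⇒a-b≡c (Q≡ (+ x))))) (minus-cong (root⇒≡0 Q x x∈roots) Qr₀≡0)
        split : ∀ x → x < p → roots Q x ≡ true → (x ≡ᵇ r₀) ∨ roots G x ≡ true
        split x x<p x∈roots with *≡0⇒≡0⊎≡0 _ _ (factor x x<p x∈roots)
        ... | inj₁ x-r₀≡0 = cong (_∨ roots G x) (≡⇒≡ᵇ-true (≡mod⇒≡ x<p r₀<p (modulo (≡0⇒∣ x-r₀≡0))))
        ... | inj₂ Gx≡0   = trans (cong ((x ≡ᵇ r₀) ∨_) (≡0⇒root G x Gx≡0)) (∨-zeroʳ (x ≡ᵇ r₀))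

module Sumsets (p : ℕ) (prime : Prime p) where

  open import Data.Bool using (Bool; true; false; _∨_; _∧_; not)
  open import Data.Bool.Properties using (∧-comm; ∧-zeroʳ; ∧-conicalˡ; ∧-conicalʳ; not-¬; not-injective)
  open import Data.Empty using (⊥-elim)
  open import Data.Integer using (ℤ; +_; _+_; _-_; -_; _*_)
  open import Data.Integer.Divisibility.Signed using (divides)
  open import Data.Integer.Properties as ℤ using ()
  open import Data.Integer.Tactic.RingSolver using (solve-∀)
  open import Data.Nat as ℕ using (zero; suc; pred; _≤_; _<_; s≤s; z<s; _≡ᵇ_; _≤?_)
  open import Data.Nat.Properties as ℕ using (suc-pred; ≤-trans; ≤-reflexive; <-irrefl; ≰⇒>)
  open import Data.Nat.Tactic.RingSolver renaming (solve-∀ to solve-∀ℕ)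
  open import Data.Product using (∃; ∃₂; _×_; _,_; proj₁; proj₂)
  open import Data.Sum using (_⊎_; inj₁; inj₂; [_,_]′)
  open import Relation.Binary.PropositionalEquality hiding ([_])
  open import Relation.Nullary using (¬_; yes; no)

  open FiniteSums
  open Congruence
  open PrimeModulus p prime
  open Residues p

  -- A subset of ℤ/p, given by its indicator on the representatives 0, …, p − 1.
  Subset : Set
  Subset = ℕ → Bool

  size : Subset → ℕ
  size = count p

  translate : Subset → ℤ → Subset
  translate A e x = A (res (+ x + e))

  translate-cong : ∀ A {e e′} → e ≡ e′ mod p → ∀ x → translate A e x ≡ translate A e′ x
  translate-cong A e≡e′ x = cong A (res-cong (+-cong (mod-refl {a = + x}) e≡e′))

  translate-translate : ∀ A e e′ x → translate (translate A e) e′ x ≡ translate A (e′ + e) x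
  translate-translate A e e′ x =
    cong A (res-cong (mod-trans (+-cong (res-≡mod (+ x + e′)) mod-refl) (mod-reflexive (ℤ.+-assoc (+ x) e′ e))))

  translate-zero : ∀ A x → x < p → translate A (+ 0) x ≡ A x
  translate-zero A x x<p = cong A (trans (cong res (ℤ.+-identityʳ (+ x))) (res-below x<p))

  size-translate-one : ∀ A → size (translate A (+ 1)) ≡ size A
  size-translate-one A =
    subst (λ n → count n (translate A (+ 1)) ≡ count n A) (suc-pred p)
          (count-rotate (pred p) A (λ x → res (+ x + + 1)) next≡suc next-last)
    where
    next≡suc : ∀ x → x < pred p → res (+ x + + 1) ≡ suc x
    next≡suc x x<p-1 = trans (cong res (ℤ.+-comm (+ x) (+ 1)))
                             (res-below (subst (suc x <_) (suc-pred p) (s≤s x<p-1)))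
    next-last : res (+ pred p + + 1) ≡ 0
    next-last = trans (res-cong (modulo (divides (+ 1) p-1+1-0≡1*p))) (res-below (subst (0 <_) (suc-pred p) z<s))
      where
      p-1+1-0≡1*p : + pred p + + 1 - + 0 ≡ + 1 * + p
      p-1+1-0≡1*p = trans (ℤ.+-identityʳ _) (trans (ℤ.+-comm (+ pred p) (+ 1))
                          (trans (cong +_ (suc-pred p)) (sym (ℤ.*-identityˡ (+ p)))))

  size-translate-+ : ∀ n A → size (translate A (+ n)) ≡ size A
  size-translate-+ zero    A = count-cong p (translate-zero A)
  size-translate-+ (suc n) A = begin
    size (translate A (+ suc n))               ≡⟨ count-cong p (λ x _ → sym (translate-translate A (+ n) (+ 1) x)) ⟩
    size (translate (translate A (+ n)) (+ 1)) ≡⟨ size-translate-one (translate A (+ n)) ⟩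
    size (translate A (+ n))                   ≡⟨ size-translate-+ n A ⟩
    size A                                     ∎
    where open ≡-Reasoning

  size-translate : ∀ A e → size (translate A e) ≡ size A
  size-translate A e =
    trans (count-cong p (λ x _ → translate-cong A (mod-sym (res-≡mod e)) x)) (size-translate-+ (res e) A)

  _⊞_ : Subset → Subset → Subset
  (A ⊞ B) z = anyBelow p (λ x → A x ∧ B (res (+ z - + x)))

  ⊞-intro : ∀ A B {x y z} → x < p → y < p → A x ≡ true → B y ≡ true → + x + + y ≡ + z mod p → (A ⊞ B) z ≡ true
  ⊞-intro A B {x} {y} {z} x<p y<p x∈A y∈B x+y≡z =
    anyBelow-intro p _ x<p (subst (λ b → A x ∧ b ≡ true) (sym (cong B z-x≡y)) (subst (λ a → a ∧ B y ≡ true) (sym x∈A) y∈B))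
    where
    z-x≡y : res (+ z - + x) ≡ y
    z-x≡y = trans (res-cong (begin
      + z - + x          ≈⟨ minus-cong x+y≡z (mod-refl {a = + x}) ⟨
      + x + + y - + x    ≡⟨ cancel (+ x) (+ y) ⟩
      + y                ∎)) (res-below y<p)
      where
      open ≡-mod-Reasoning p
      cancel : ∀ x y → x + y - x ≡ y
      cancel = solve-∀

  ⊞-elim : ∀ {A B z} → (A ⊞ B) z ≡ true →
           ∃₂ λ x y → x < p × y < p × A x ≡ true × B y ≡ true × (+ x + + y ≡ + z mod p)
  ⊞-elim {A} {B} {z} z∈A⊞B with anyBelow-elim p _ z∈A⊞B
  ... | x , x<p , x∈A∧z-x∈B =
    x , res (+ z - + x) , x<p , res<p _ , ∧-conicalˡ _ _ x∈A∧z-x∈B , ∧-conicalʳ _ _ x∈A∧z-x∈B , (begin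
      + x + + res (+ z - + x)   ≈⟨ +-cong (mod-refl {a = + x}) (res-≡mod (+ z - + x)) ⟩
      + x + (+ z - + x)         ≡⟨ cancel (+ x) (+ z) ⟩
      + z                       ∎)
    where
    open ≡-mod-Reasoning p
    cancel : ∀ x z → x + (z - x) ≡ z
    cancel = solve-∀

  size-⊞-≥ˡ : ∀ A B {b} → b < p → B b ≡ true → size A ≤ size (A ⊞ B)
  size-⊞-≥ˡ A B {b} b<p b∈B = begin
    size A                      ≡⟨ size-translate A (- + b) ⟨
    size (translate A (- + b))  ≤⟨ count-mono p (λ z _ z-b∈A → ⊞-intro A B (res<p _) b<p z-b∈A b∈B (z-b+b≡z z)) ⟩
    size (A ⊞ B)                ∎
    where
    open ℕ.≤-Reasoning
    cancel : ∀ z b → z + - b + b ≡ z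
    cancel = solve-∀
    z-b+b≡z : ∀ z → + res (+ z + - + b) + + b ≡ + z mod p
    z-b+b≡z z = mod-trans (+-cong (res-≡mod (+ z + - + b)) (mod-refl {a = + b})) (mod-reflexive (cancel (+ z) (+ b)))

  other-element : ∀ B {b₁} → b₁ < p → 2 ≤ size B → ∃ λ b₂ → b₂ < p × B b₂ ≡ true × b₂ ≢ b₁
  other-element B {b₁} b₁<p 2≤|B| = distinct (count-witness p B∖b₁ 0<|B∖b₁|)
    where
    B∖b₁ : Subset
    B∖b₁ x = B x ∧ not (x ≡ᵇ b₁)
    cover : ∀ b c → b ≡ true → (b ∧ not c) ∨ c ≡ true
    cover true true  _ = refl
    cover true false _ = refl
    0<|B∖b₁| : 0 < count p B∖b₁
    0<|B∖b₁| = ℕ.+-cancelʳ-≤ 1 1 (count p B∖b₁) (begin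
      2                                         ≤⟨ 2≤|B| ⟩
      size B                                    ≤⟨ count-mono p (λ x _ → cover (B x) (x ≡ᵇ b₁)) ⟩
      count p (λ x → B∖b₁ x ∨ (x ≡ᵇ b₁))        ≤⟨ count-∨ p B∖b₁ (_≡ᵇ b₁) ⟩
      count p B∖b₁ ℕ.+ count p (_≡ᵇ b₁)         ≡⟨ cong (count p B∖b₁ ℕ.+_) (count-≡ᵇ p b₁<p) ⟩
      count p B∖b₁ ℕ.+ 1                        ∎)
      where open ℕ.≤-Reasoning
    distinct : (∃ λ b₂ → b₂ < p × B∖b₁ b₂ ≡ true) → ∃ λ b₂ → b₂ < p × B b₂ ≡ true × b₂ ≢ b₁
    distinct (b₂ , b₂<p , b₂∈B∖b₁) =
      b₂ , b₂<p , ∧-conicalˡ _ _ b₂∈B∖b₁ ,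
      λ b₂≡b₁ → not-¬ (sym (≡⇒≡ᵇ-true b₂≡b₁)) (sym (∧-conicalʳ _ _ b₂∈B∖b₁))

  closed⇒full : ∀ (A : Subset) {d a₀} → ¬ d ≡ + 0 mod p → a₀ < p → A a₀ ≡ true →
                (∀ x → x < p → A x ≡ true → A (res (+ x + d)) ≡ true) → ∀ z → z < p → A z ≡ true
  closed⇒full A {d} {a₀} d≢0 a₀<p a₀∈A closed z z<p =
    subst (λ n → A n ≡ true) (res-below z<p) (subst (λ n → A n ≡ true) (res-cong reach) (orbit k))
    where
    step : ∀ a k d → a + k * d + d ≡ a + (+ 1 + k) * d
    step = solve-∀
    orbit : ∀ k → A (res (+ a₀ + + k * d)) ≡ true
    orbit zero    = subst (λ n → A n ≡ true) (sym (trans (cong res (ℤ.+-identityʳ (+ a₀))) (res-below a₀<p))) a₀∈A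
    orbit (suc k) = subst (λ n → A n ≡ true)
                          (res-cong (mod-trans (+-cong (res-≡mod _) (mod-refl {a = d})) (mod-reflexive (step (+ a₀) (+ k) d))))
                          (closed _ (res<p _) (orbit k))
    w : ℤ
    w = proj₁ (inverse d≢0)
    k : ℕ
    k = res (w * (+ z - + a₀))
    reach : + a₀ + + k * d ≡ + z mod p
    reach = begin
      + a₀ + + k * d                    ≈⟨ +-cong (mod-refl {a = + a₀}) (*-congʳ d (res-≡mod (w * (+ z - + a₀)))) ⟩
      + a₀ + w * (+ z - + a₀) * d       ≡⟨ regroup (+ a₀) (+ z) w d ⟩
      + a₀ + (+ z - + a₀) * (w * d)     ≈⟨ +-cong (mod-refl {a = + a₀}) (*-congˡ (+ z - + a₀) (proj₂ (inverse d≢0))) ⟩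
      + a₀ + (+ z - + a₀) * + 1         ≡⟨ cancel (+ a₀) (+ z) ⟩
      + z                               ∎
      where
      open ≡-mod-Reasoning p
      regroup : ∀ a z w d → a + w * (z - a) * d ≡ a + (z - a) * (w * d)
      regroup = solve-∀
      cancel : ∀ a z → a + (z - a) * + 1 ≡ z
      cancel = solve-∀

  escape : ∀ A {d} → ¬ d ≡ + 0 mod p → 0 < size A → size A < p →
           ∃ λ a → a < p × A a ≡ true × A (res (+ a + d)) ≡ false
  escape A {d} d≢0 0<|A| |A|<p = [ closed-contradiction , exit ]′ (count≡0⊎member p Exit)
    where
    Escape : Set
    Escape = ∃ λ a → a < p × A a ≡ true × A (res (+ a + d)) ≡ false
    Exit : Subset
    Exit x = A x ∧ not (A (res (+ x + d)))
    exit : (∃ λ a → a < p × Exit a ≡ true) → Escape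
    exit (a , a<p , a∈Exit) = a , a<p , ∧-conicalˡ _ _ a∈Exit , not-injective (∧-conicalʳ _ _ a∈Exit)
    stays : ∀ a b → a ∧ not b ≡ false → a ≡ true → b ≡ true
    stays true true _ _ = refl
    closed-contradiction : count p Exit ≡ 0 → Escape
    closed-contradiction |Exit|≡0 =
      let (a₀ , a₀<p , a₀∈A) = count-witness p A 0<|A|
          closed : ∀ x → x < p → A x ≡ true → A (res (+ x + d)) ≡ true
          closed x x<p = stays (A x) _ (count-zero p Exit |Exit|≡0 x x<p)
      in  ⊥-elim (<-irrefl (count-all p (closed⇒full A d≢0 a₀<p a₀∈A closed)) |A|<p)

  -- Dyson's e-transform: A′ = A ∪ (B + e) and B′ = B ∩ (A − e).
  module DysonTransform (A B : Subset) (e : ℤ) where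

    A′ B′ : Subset
    A′ x = A x ∨ translate B (- e) x
    B′ y = B y ∧ translate A e y

    size-A′+B′ : size A′ ℕ.+ size B′ ≡ size A ℕ.+ size B
    size-A′+B′ = begin
      size A′ ℕ.+ size B′                                   ≡⟨ cong (size A′ ℕ.+_) (trans (count-cong p B′≡A∩B+e) (size-translate A∩B+e e)) ⟩
      size A′ ℕ.+ size A∩B+e                                ≡⟨ count-∨-∧ p A (translate B (- e)) ⟩
      size A ℕ.+ size (translate B (- e))                   ≡⟨ cong (size A ℕ.+_) (size-translate B (- e)) ⟩
      size A ℕ.+ size B                                     ∎
      where
      open ≡-Reasoning
      A∩B+e : Subset
      A∩B+e x = A x ∧ translate B (- e) x
      cancel : ∀ y e → y + e + - e ≡ y
      cancel = solve-∀
      B′≡A∩B+e : ∀ y → y < p → B′ y ≡ translate A∩B+e e y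
      B′≡A∩B+e y y<p = trans (∧-comm (B y) _) (cong (λ n → A (res (+ y + e)) ∧ B n) (sym (trans
        (res-cong (mod-trans (+-cong (res-≡mod (+ y + e)) (mod-refl { a = - e})) (mod-reflexive (cancel (+ y) e))))
        (res-below y<p))))

    ⊞-⊆ : ∀ z → (A′ ⊞ B′) z ≡ true → (A ⊞ B) z ≡ true
    ⊞-⊆ z z∈A′⊞B′ with ⊞-elim {A′} {B′} z∈A′⊞B′
    ... | x , y , x<p , y<p , x∈A′ , y∈B′ , x+y≡z with ∨-true (A x) x∈A′
    ...   | inj₁ x∈A   = ⊞-intro A B x<p y<p x∈A (∧-conicalˡ _ _ y∈B′) x+y≡z
    ...   | inj₂ x-e∈B = ⊞-intro A B (res<p _) (res<p _) (∧-conicalʳ _ _ y∈B′) x-e∈B (begin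
        + res (+ y + e) + + res (+ x + - e)   ≈⟨ +-cong (res-≡mod (+ y + e)) (res-≡mod (+ x + - e)) ⟩
        + y + e + (+ x + - e)                 ≡⟨ swap (+ y) e (+ x) ⟩
        + x + + y                             ≈⟨ x+y≡z ⟩
        + z                                   ∎)
      where
      open ≡-mod-Reasoning p
      swap : ∀ y e x → y + e + (x + - e) ≡ x + y
      swap = solve-∀

    size-⊞-≤ : size (A′ ⊞ B′) ≤ size (A ⊞ B)
    size-⊞-≤ = count-mono p (λ z _ → ⊞-⊆ z)

    size-A≤A′ : size A ≤ size A′
    size-A≤A′ = count-mono p (λ x _ x∈A → cong (_∨ translate B (- e) x) x∈A)

    ∈B′ : ∀ {b} → B b ≡ true → translate A e b ≡ true → B′ b ≡ true
    ∈B′ b∈B b+e∈A = cong₂ _∧_ b∈B b+e∈A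

    size-B′<B : ∀ {b} → b < p → B b ≡ true → translate A e b ≡ false → size B′ < size B
    size-B′<B b<p b∈B b+e∉A = count-mono-< p (λ y _ → ∧-conicalˡ _ _) _ b<p
      (trans (cong (B _ ∧_) b+e∉A) (∧-zeroʳ (B _))) b∈B

  -- min (p , |A| + |B| − 1) ≤ |A ⊞ B|, stated without truncated subtraction.
  CauchyDavenport : Subset → Subset → Set
  CauchyDavenport A B = p ≤ size (A ⊞ B) ⊎ size A ℕ.+ size B ≤ size (A ⊞ B) ℕ.+ 1

  module _ (A B : Subset) (e : ℤ) where
    open DysonTransform A B e

    cauchy-davenport-transfer : CauchyDavenport A′ B′ → CauchyDavenport A B
    cauchy-davenport-transfer (inj₁ p≤|A′⊞B′|) = inj₁ (≤-trans p≤|A′⊞B′| size-⊞-≤)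
    cauchy-davenport-transfer (inj₂ |A′|+|B′|≤) = inj₂ (begin
      size A ℕ.+ size B               ≡⟨ size-A′+B′ ⟨
      size A′ ℕ.+ size B′             ≤⟨ |A′|+|B′|≤ ⟩
      size (A′ ⊞ B′) ℕ.+ 1            ≤⟨ ℕ.+-monoˡ-≤ 1 size-⊞-≤ ⟩
      size (A ⊞ B) ℕ.+ 1              ∎)
      where open ℕ.≤-Reasoning

  cauchy-davenport-≤ : ∀ n A B → size B ≤ n → 0 < size A → 0 < size B → CauchyDavenport A B
  cauchy-davenport-≤ zero A B |B|≤0 _ 0<|B| = ⊥-elim (<-irrefl refl (≤-trans 0<|B| |B|≤0))
  cauchy-davenport-≤ (suc n) A B |B|≤1+n 0<|A| 0<|B| with count-witness p B 0<|B| | size B ≤? 1 | p ≤? size A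
  ... | b₁ , b₁<p , b₁∈B | yes |B|≤1 | _         = inj₂ (ℕ.+-mono-≤ (size-⊞-≥ˡ A B b₁<p b₁∈B) |B|≤1)
  ... | b₁ , b₁<p , b₁∈B | no  _     | yes p≤|A| = inj₁ (≤-trans p≤|A| (size-⊞-≥ˡ A B b₁<p b₁∈B))
  -- With b₂ ≠ b₁ in B and a ∈ A such that a + (b₂ − b₁) ∉ A, the e-transform for e = a − b₁
  -- keeps b₁ in B′ but removes b₂, so the induction hypothesis applies to (A′ , B′).
  ... | b₁ , b₁<p , b₁∈B | no  1≱|B| | no  p≰|A| =
    let (b₂ , b₂<p , b₂∈B , b₂≢b₁) = other-element B b₁<p (≰⇒> 1≱|B|)
        d≢0 : ¬ + b₂ - + b₁ ≡ + 0 mod p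
        d≢0 d≡0 = b₂≢b₁ (≡mod⇒≡ b₂<p b₁<p (modulo (≡0⇒∣ d≡0)))
        (a , a<p , a∈A , a+d∉A) = escape A d≢0 0<|A| (≰⇒> p≰|A|)
        e : ℤ
        e = + a - + b₁
        open DysonTransform A B e
        b₁+e∈A : translate A e b₁ ≡ true
        b₁+e∈A = subst (λ x → A x ≡ true) (sym (trans (cong res (b+[a-b]≡a (+ b₁) (+ a))) (res-below a<p))) a∈A
        b₂+e∉A : translate A e b₂ ≡ false
        b₂+e∉A = subst (λ x → A x ≡ false) (cong res (a+[c-b]≡c+[a-b] (+ a) (+ b₁) (+ b₂))) a+d∉A
    in  cauchy-davenport-transfer A B e (cauchy-davenport-≤ n A′ B′
          (ℕ.≤-pred (≤-trans (size-B′<B b₂<p b₂∈B b₂+e∉A) |B|≤1+n))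
          (≤-trans 0<|A| size-A≤A′)
          (count-member p b₁<p (∈B′ b₁∈B b₁+e∈A)))
    where
    b+[a-b]≡a : ∀ b a → b + (a - b) ≡ a
    b+[a-b]≡a = solve-∀
    a+[c-b]≡c+[a-b] : ∀ a b c → a + (c - b) ≡ c + (a - b)
    a+[c-b]≡c+[a-b] = solve-∀

  cauchy-davenport : ∀ A B → 0 < size A → 0 < size B → CauchyDavenport A B
  cauchy-davenport A B = cauchy-davenport-≤ (size B) A B ℕ.≤-refl

  module _ (S : ℕ → Subset) (B : Subset) {w : ℕ} (|B|≡1+w : size B ≡ suc w)
           (S⊞B⊆S : ∀ j → size (S j ⊞ B) ≤ size (S (suc j))) where

    size-step : ∀ j → size (S j) ℕ.+ size B ≤ size (S j ⊞ B) ℕ.+ 1 → size (S j) ℕ.+ w ≤ size (S (suc j))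
    size-step j |Sⱼ|+|B|≤ = ≤-trans (ℕ.≤-pred (begin
      suc (size (S j) ℕ.+ w)       ≡⟨ ℕ.+-suc (size (S j)) w ⟨
      size (S j) ℕ.+ suc w         ≡⟨ cong (size (S j) ℕ.+_) |B|≡1+w ⟨
      size (S j) ℕ.+ size B        ≤⟨ |Sⱼ|+|B|≤ ⟩
      size (S j ⊞ B) ℕ.+ 1         ≡⟨ ℕ.+-comm _ 1 ⟩
      suc (size (S j ⊞ B))         ∎)) (S⊞B⊆S j)
      where open ℕ.≤-Reasoning

    chain-growth : 0 < size (S 0) → ∀ j → p ≤ size (S j) ⊎ size (S 0) ℕ.+ j ℕ.* w ≤ size (S j)
    chain-growth 0<|S₀| zero    = inj₂ (≤-reflexive (ℕ.+-identityʳ (size (S 0))))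
    chain-growth 0<|S₀| (suc j) =
      let IH = chain-growth 0<|S₀| j in step IH (cauchy-davenport (S j) B (nonempty IH) 0<|B|)
      where
      0<|B| : 0 < size B
      0<|B| = subst (0 <_) (sym |B|≡1+w) z<s
      nonempty : p ≤ size (S j) ⊎ size (S 0) ℕ.+ j ℕ.* w ≤ size (S j) → 0 < size (S j)
      nonempty (inj₁ p≤|Sⱼ|)       = ℕ.<-≤-trans (ℕ.>-nonZero⁻¹ p) p≤|Sⱼ|
      nonempty (inj₂ |S₀|+jw≤|Sⱼ|) = ≤-trans 0<|S₀| (≤-trans (ℕ.m≤m+n _ _) |S₀|+jw≤|Sⱼ|)
      regroup : ∀ s j w → s ℕ.+ suc j ℕ.* w ≡ s ℕ.+ j ℕ.* w ℕ.+ w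
      regroup = solve-∀ℕ
      step : p ≤ size (S j) ⊎ size (S 0) ℕ.+ j ℕ.* w ≤ size (S j) → CauchyDavenport (S j) B →
             p ≤ size (S (suc j)) ⊎ size (S 0) ℕ.+ suc j ℕ.* w ≤ size (S (suc j))
      step _                    (inj₁ p≤|Sⱼ⊞B|)  = inj₁ (≤-trans p≤|Sⱼ⊞B| (S⊞B⊆S j))
      step (inj₁ p≤|Sⱼ|)        (inj₂ |Sⱼ|+|B|≤) = inj₁ (≤-trans p≤|Sⱼ| (≤-trans (ℕ.m≤m+n _ w) (size-step j |Sⱼ|+|B|≤)))
      step (inj₂ |S₀|+jw≤|Sⱼ|) (inj₂ |Sⱼ|+|B|≤) = inj₂ (begin
        size (S 0) ℕ.+ suc j ℕ.* w      ≡⟨ regroup (size (S 0)) j w ⟩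
        size (S 0) ℕ.+ j ℕ.* w ℕ.+ w    ≤⟨ ℕ.+-monoˡ-≤ w |S₀|+jw≤|Sⱼ| ⟩
        size (S j) ℕ.+ w                ≤⟨ size-step j |Sⱼ|+|B|≤ ⟩
        size (S (suc j))                ∎)
        where open ℕ.≤-Reasoning

module Binomials where

  open import Data.Integer using (+_; _+_; _*_; _-_)
  open import Data.Integer.Properties using (pos-+)
  open import Data.Integer.Tactic.RingSolver using (solve-∀)
  open import Data.Nat using (zero; suc)
  open import Data.Nat.Combinatorics using (_C_; nC1≡n; nCk+nC[k+1]≡[n+1]C[k+1])
  open import Relation.Binary.PropositionalEquality

  pascal : ∀ n k → + (suc n C suc k) ≡ + (n C k) + + (n C suc k)
  pascal n k = trans (cong +_ (sym (nCk+nC[k+1]≡[n+1]C[k+1] n k))) (pos-+ (n C k) (n C suc k))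

  2*C2 : ∀ n → + 2 * + (n C 2) ≡ + n * (+ n - + 1)
  2*C2 zero    = refl
  2*C2 (suc n) = begin
    + 2 * + (suc n C 2)                  ≡⟨ cong (+ 2 *_) (pascal n 1) ⟩
    + 2 * (+ (n C 1) + + (n C 2))        ≡⟨ cong (λ t → + 2 * (+ t + + (n C 2))) (nC1≡n n) ⟩
    + 2 * (+ n + + (n C 2))              ≡⟨ distrib (+ n) (+ (n C 2)) ⟩
    + 2 * + n + + 2 * + (n C 2)          ≡⟨ cong (_+_ (+ 2 * + n)) (2*C2 n) ⟩
    + 2 * + n + + n * (+ n - + 1)        ≡⟨ step (+ n) ⟩
    + suc n * (+ suc n - + 1)            ∎
    where
    open ≡-Reasoning
    distrib : ∀ a b → + 2 * (a + b) ≡ + 2 * a + + 2 * b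
    distrib = solve-∀
    step : ∀ n → + 2 * n + n * (n - + 1) ≡ (+ 1 + n) * (+ 1 + n - + 1)
    step = solve-∀

  6*C3 : ∀ n → + 6 * + (n C 3) ≡ + n * (+ n - + 1) * (+ n - + 2)
  6*C3 zero    = refl
  6*C3 (suc n) = begin
    + 6 * + (suc n C 3)                                      ≡⟨ cong (+ 6 *_) (pascal n 2) ⟩
    + 6 * (+ (n C 2) + + (n C 3))                            ≡⟨ distrib (+ (n C 2)) (+ (n C 3)) ⟩
    + 3 * (+ 2 * + (n C 2)) + + 6 * + (n C 3)                ≡⟨ cong₂ (λ a b → + 3 * a + b) (2*C2 n) (6*C3 n) ⟩
    + 3 * (+ n * (+ n - + 1)) + + n * (+ n - + 1) * (+ n - + 2) ≡⟨ step (+ n) ⟩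
    + suc n * (+ suc n - + 1) * (+ suc n - + 2)              ∎
    where
    open ≡-Reasoning
    distrib : ∀ a b → + 6 * (a + b) ≡ + 3 * (+ 2 * a) + + 6 * b
    distrib = solve-∀
    step : ∀ n → + 3 * (n * (n - + 1)) + n * (n - + 1) * (n - + 2) ≡ (+ 1 + n) * (+ 1 + n - + 1) * (+ 1 + n - + 2)
    step = solve-∀

  24*C4 : ∀ n → + 24 * + (n C 4) ≡ + n * (+ n - + 1) * (+ n - + 2) * (+ n - + 3)
  24*C4 zero    = refl
  24*C4 (suc n) = begin
    + 24 * + (suc n C 4)                                   ≡⟨ cong (+ 24 *_) (pascal n 3) ⟩
    + 24 * (+ (n C 3) + + (n C 4))                         ≡⟨ distrib (+ (n C 3)) (+ (n C 4)) ⟩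
    + 4 * (+ 6 * + (n C 3)) + + 24 * + (n C 4)             ≡⟨ cong₂ (λ a b → + 4 * a + b) (6*C3 n) (24*C4 n) ⟩
    + 4 * (+ n * (+ n - + 1) * (+ n - + 2)) + + n * (+ n - + 1) * (+ n - + 2) * (+ n - + 3)
                                                           ≡⟨ step (+ n) ⟩
    + suc n * (+ suc n - + 1) * (+ suc n - + 2) * (+ suc n - + 3) ∎
    where
    open ≡-Reasoning
    distrib : ∀ a b → + 24 * (a + b) ≡ + 4 * (+ 6 * a) + + 24 * b
    distrib = solve-∀
    step : ∀ n → + 4 * (n * (n - + 1) * (n - + 2)) + n * (n - + 1) * (n - + 2) * (n - + 3)
                 ≡ (+ 1 + n) * (+ 1 + n - + 1) * (+ 1 + n - + 2) * (+ 1 + n - + 3)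
    step = solve-∀

module Quartic (a b c : ℤ) where

  open import Data.Integer using (+_; _+_; _*_; _-_)
  open import Data.Integer.Properties using (+-identityˡ; *-zeroˡ)
  open import Data.Integer.Tactic.RingSolver using (solve-∀)
  open import Data.Nat.Combinatorics using (_C_)
  open import Relation.Binary.PropositionalEquality

  open Binomials
  open PolynomialFunctions using (Degree≤; Degree≤-horner; Degree≤-const; Degree≤-resp-≗)

  c₁ c₂ c₃ c₄ : ℤ
  c₁ = + 8 * b - + 6 * a - + 12 * c + + 24
  c₂ = + 11 * a - + 12 * b + + 12 * c
  c₃ = + 4 * b - + 6 * a
  c₄ = a

  -- Opaque: only the facts proved in this block are used, and letting Agda unfold F and F′
  -- (or f) makes type checking prohibitively slow.
  opaque
    F F′ : ℤ → ℤ
    F  x = x * (c₁ + x * (c₂ + x * (c₃ + x * c₄)))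
    F′ x = c₁ + x * (+ 2 * c₂ + x * (+ 3 * c₃ + x * (+ 4 * c₄)))

    24*f≡F : ∀ n → + 24 * f a b c n ≡ F (+ n)
    24*f≡F n = begin
      + 24 * f a b c n                                                   ≡⟨ distrib a b c (+ n) (+ (n C 2)) (+ (n C 3)) (+ (n C 4)) ⟩
      a * (+ 24 * + (n C 4)) + + 4 * b * (+ 6 * + (n C 3)) + + 12 * c * (+ 2 * + (n C 2)) + + 24 * + n
           ≡⟨ cong₂ _+_ (cong₂ _+_ (cong₂ _+_ (cong (a *_) (24*C4 n)) (cong (+ 4 * b *_) (6*C3 n))) (cong (+ 12 * c *_) (2*C2 n))) refl ⟩
      a * (+ n * (+ n - + 1) * (+ n - + 2) * (+ n - + 3)) + + 4 * b * (+ n * (+ n - + 1) * (+ n - + 2))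
        + + 12 * c * (+ n * (+ n - + 1)) + + 24 * + n                    ≡⟨ expand a b c (+ n) ⟩
      F (+ n)                                                            ∎
      where
      open ≡-Reasoning
      distrib : ∀ a b c n X₂ X₃ X₄ → + 24 * (a * X₄ + b * X₃ + c * X₂ + n)
                ≡ a * (+ 24 * X₄) + + 4 * b * (+ 6 * X₃) + + 12 * c * (+ 2 * X₂) + + 24 * n
      distrib = solve-∀
      expand : ∀ a b c n → a * (n * (n - + 1) * (n - + 2) * (n - + 3)) + + 4 * b * (n * (n - + 1) * (n - + 2))
                           + + 12 * c * (n * (n - + 1)) + + 24 * n
               ≡ n * ((+ 8 * b - + 6 * a - + 12 * c + + 24) + n * ((+ 11 * a - + 12 * b + + 12 * c)
                    + n * ((+ 4 * b - + 6 * a) + n * a)))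
      expand = solve-∀

    F-degree : Degree≤ 4 F
    F-degree = Degree≤-resp-≗ 4 (λ x → +-identityˡ (F x))
      (Degree≤-horner 3 (+ 0) (Degree≤-horner 2 c₁ (Degree≤-horner 1 c₂ (Degree≤-horner 0 c₃ (Degree≤-const 0 c₄)))))

    F′-degree : Degree≤ 3 F′
    F′-degree = Degree≤-horner 2 c₁ (Degree≤-horner 1 (+ 2 * c₂) (Degree≤-horner 0 (+ 3 * c₃) (Degree≤-const 0 (+ 4 * c₄))))

    K : ℤ → ℤ → ℤ
    K n h = c₂ + c₃ * (+ 3 * n + h) + c₄ * (+ 6 * n * n + + 4 * n * h + h * h)

    taylor : ∀ n h → F (n + h) ≡ F n + h * F′ n + h * h * K n h
    taylor n h = expand c₁ c₂ c₃ c₄ n h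
      where
      expand : ∀ c₁ c₂ c₃ c₄ n h →
        (n + h) * (c₁ + (n + h) * (c₂ + (n + h) * (c₃ + (n + h) * c₄)))
        ≡ n * (c₁ + n * (c₂ + n * (c₃ + n * c₄))) + h * (c₁ + n * (+ 2 * c₂ + n * (+ 3 * c₃ + n * (+ 4 * c₄))))
          + h * h * (c₂ + c₃ * (+ 3 * n + h) + c₄ * (+ 6 * n * n + + 4 * n * h + h * h))
      expand = solve-∀

    F0≡0 : F (+ 0) ≡ + 0
    F0≡0 = *-zeroˡ (c₁ + + 0 * (c₂ + + 0 * (c₃ + + 0 * c₄)))

    F1≡24 : F (+ 1) ≡ + 24
    F1≡24 = eval a b c
      where
      eval : ∀ a b c → + 1 * ((+ 8 * b - + 6 * a - + 12 * c + + 24) + + 1 * ((+ 11 * a - + 12 * b + + 12 * c)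
                         + + 1 * ((+ 4 * b - + 6 * a) + + 1 * a))) ≡ + 24
      eval = solve-∀

    -- As F 1 = 24, F′ cannot vanish mod p at all of 0, 1, 2, 3.
    F′-combination : + 9 * F′ (+ 0) + + 19 * F′ (+ 1) - + 5 * F′ (+ 2) + F′ (+ 3) ≡ + 24 * F (+ 1)
    F′-combination = weights c₁ c₂ c₃ c₄
      where
      weights : ∀ c₁ c₂ c₃ c₄ →
        + 9 * (c₁ + + 0 * (+ 2 * c₂ + + 0 * (+ 3 * c₃ + + 0 * (+ 4 * c₄))))
        + + 19 * (c₁ + + 1 * (+ 2 * c₂ + + 1 * (+ 3 * c₃ + + 1 * (+ 4 * c₄))))
        - + 5 * (c₁ + + 2 * (+ 2 * c₂ + + 2 * (+ 3 * c₃ + + 2 * (+ 4 * c₄))))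
        + (c₁ + + 3 * (+ 2 * c₂ + + 3 * (+ 3 * c₃ + + 3 * (+ 4 * c₄))))
        ≡ + 24 * (+ 1 * (c₁ + + 1 * (c₂ + + 1 * (c₃ + + 1 * c₄))))
      weights = solve-∀

module CountingTuples where

  open import Data.Empty using (⊥-elim)
  open import Data.Integer as ℤ using (ℤ; +_; _-_)
  open import Data.Integer.Divisibility using (_∣_)
  open import Data.Integer.Tactic.RingSolver using (solve-∀)
  open import Data.List using (List; []; _∷_; _++_; map; filter; length; concatMap; applyUpTo; upTo)
  open import Data.List.Properties using (filter-++; length-++; map-∘; filter-some)
  open import Data.List.Relation.Unary.Any using (here)
  open import Data.Nat using (ℕ; zero; suc; _+_; _≤_; z≤n; s≤s)
  open import Data.Nat.ListAction using (sum)
  import Data.Nat.Properties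
  open import Data.Nat.Properties using (+-mono-≤; m≤n⇒m≤1+n)
  open import Data.Vec using (Vec; []; _∷_)
  open import Function using (_∘_)
  open import Level using (0ℓ)
  open import Relation.Binary.PropositionalEquality
  open import Relation.Nullary using (yes; no)
  open import Relation.Unary using (Pred; Decidable)

  open FiniteSums

  module _ {A B : Set} {P : Pred B 0ℓ} (P? : Decidable P) where

    length-filter-concatMap : ∀ (g : A → List B) xs →
      length (filter P? (concatMap g xs)) ≡ sum (map (length ∘ filter P? ∘ g) xs)
    length-filter-concatMap g []       = refl
    length-filter-concatMap g (x ∷ xs) = begin
      length (filter P? (g x ++ concatMap g xs))                  ≡⟨ cong length (filter-++ P? (g x) _) ⟩
      length (filter P? (g x) ++ filter P? (concatMap g xs))      ≡⟨ length-++ (filter P? (g x)) ⟩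
      length (filter P? (g x)) + length (filter P? (concatMap g xs))       ≡⟨ cong (_+_ _) (length-filter-concatMap g xs) ⟩
      length (filter P? (g x)) + sum (map (length ∘ filter P? ∘ g) xs)     ∎
      where open ≡-Reasoning

    length-filter-map-≥ : ∀ {Q : Pred A 0ℓ} (Q? : Decidable Q) (h : A → B) → (∀ x → Q x → P (h x)) →
      ∀ xs → length (filter Q? xs) ≤ length (filter P? (map h xs))
    length-filter-map-≥ Q? h Q⇒P []       = z≤n
    length-filter-map-≥ Q? h Q⇒P (x ∷ xs) with Q? x | P? (h x)
    ... | yes Qx | yes _   = s≤s (length-filter-map-≥ Q? h Q⇒P xs)
    ... | yes Qx | no ¬Phx = ⊥-elim (¬Phx (Q⇒P x Qx))
    ... | no _   | yes _   = m≤n⇒m≤1+n (length-filter-map-≥ Q? h Q⇒P xs)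
    ... | no _   | no _    = length-filter-map-≥ Q? h Q⇒P xs

  sum-map-mono : ∀ {A : Set} {g h : A → ℕ} → (∀ x → g x ≤ h x) → ∀ xs → sum (map g xs) ≤ sum (map h xs)
  sum-map-mono g≤h []       = z≤n
  sum-map-mono g≤h (x ∷ xs) = +-mono-≤ (g≤h x) (sum-map-mono g≤h xs)

  sum-map-applyUpTo : ∀ (h g : ℕ → ℕ) N → sum (map h (applyUpTo g N)) ≡ ∑ N (h ∘ g)
  sum-map-applyUpTo h g zero    = refl
  sum-map-applyUpTo h g (suc N) = cong (_+_ (h (g 0))) (sum-map-applyUpTo h (g ∘ suc) N)

  sum-map-range1 : ∀ (h : ℕ → ℕ) q → sum (map h (range1 q)) ≡ ∑ q (h ∘ suc)
  sum-map-range1 h q = trans (cong sum (sym (map-∘ (upTo q)))) (sum-map-applyUpTo (h ∘ suc) (λ i → i) q)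

  module _ (a b c : ℤ) (q : ℕ) where

    M-zero : ∀ {m} → + q ∣ (+ 0 - m) → 1 ≤ M a b c 0 m q
    M-zero q∣-m = filter-some (λ v → (+ q) ∣ℤ? (fsum a b c v - _)) (here q∣-m)

    M-suc : ∀ s m → ∑ q (λ i → M a b c s (m - f a b c (suc i)) q) ≤ M a b c (suc s) m q
    M-suc s m = begin
      ∑ q (λ i → M a b c s (m - f a b c (suc i)) q)                        ≡⟨ sum-map-range1 (λ n → M a b c s (m - f a b c n) q) q ⟨
      sum (map (λ n → M a b c s (m - f a b c n) q) (range1 q))             ≤⟨ sum-map-mono (λ n → length-filter-map-≥ P? _ (n ∷_) (shift n) (tuples q s)) (range1 q) ⟩
      sum (map (λ n → length (filter P? (map (n ∷_) (tuples q s)))) (range1 q)) ≡⟨ length-filter-concatMap P? (λ n → map (n ∷_) (tuples q s)) (range1 q) ⟨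
      M a b c (suc s) m q                                                  ∎
      where
      open Data.Nat.Properties.≤-Reasoning
      P? : Decidable (λ (v : Vec ℕ (suc s)) → + q ∣ (fsum a b c v - m))
      P? v = (+ q) ∣ℤ? (fsum a b c v - m)
      regroup : ∀ x a m → x - (m - a) ≡ a ℤ.+ x - m
      regroup = solve-∀
      shift : ∀ n (v : Vec ℕ s) → + q ∣ (fsum a b c v - (m - f a b c n)) → + q ∣ (fsum a b c (n ∷ v) - m)
      shift n v = subst (+ q ∣_) (regroup (fsum a b c v) (f a b c n) m)

module QuarticWaring (p : ℕ) (prime : Prime p) (4<p : 4 < p) (a b c : ℤ) where

  open import Data.Bool using (true; false)
  open import Data.Empty using (⊥-elim)
  open import Data.Integer as ℤ using (+_; _+_; _*_; _-_; -_)
  open import Data.Integer.Divisibility.Signed using (_∣_; divides; ∣⇒∣ᵤ)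
  open import Data.Integer.Properties as ℤ using ()
  open import Data.Integer.Tactic.RingSolver using (solve-∀)
  open import Data.Nat as ℕ using (ℕ; zero; suc; _<_; _≤_; z≤n; s≤s; z<s; _≡ᵇ_; _^_)
  open import Data.Nat.Properties as ℕ using (≤-trans; ≤-reflexive; <⇒≱)
  open import Data.Nat.Tactic.RingSolver renaming (solve-∀ to solve-∀ℕ)
  open import Data.Product using (∃; _×_; _,_; proj₁; proj₂)
  open import Data.Sum using (_⊎_; inj₁; inj₂; [_,_]′)
  open import Function using (_∘_)
  open import Relation.Binary.PropositionalEquality hiding ([_])
  open import Relation.Nullary using (¬_; Dec; yes; no; contradiction)
  open import Relation.Nullary.Decidable using (toSum)

  open FiniteSums
  open Congruence
  open PolynomialFunctions
  open PrimeModulus p prime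
  open Residues p
  open Sumsets p prime
  open CountingTuples using (M-zero; M-suc)
  open RootBound p prime
  open Quartic a b c

  24≢0 : ¬ + 24 ≡ + 0 mod p
  24≢0 = ≢0-* 2≢0 (≢0-* 2≢0 (≢0-* 2≢0 3≢0))
    where
    3<p : 3 < p
    3<p = ℕ.<-trans (ℕ.n<1+n 3) 4<p
    2≢0 : ¬ + 2 ≡ + 0 mod p
    2≢0 = ≢0-below z<s (ℕ.<-trans (ℕ.n<1+n 2) 3<p)
    3≢0 : ¬ + 3 ≡ + 0 mod p
    3≢0 = ≢0-below z<s 3<p

  value : ℕ → ℕ
  value r = res (f a b c (suc r))

  V : Subset
  V y = anyBelow p (λ r → y ≡ᵇ value r)

  Q : ℕ → ℤ → ℤ
  Q y x = F (x + + 1) - + 24 * + y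

  Q-degree : ∀ y → Degree≤ 4 (Q y)
  Q-degree y = Degree≤-resp-≗ 4 (λ x → minus-as-+ (F (x + + 1)) (+ 24 * + y))
    (Degree≤-+-* 4 (Degree≤-shift 4 F-degree (+ 1)) (Degree≤-const 4 (+ 24 * + y)) (- + 1))
    where
    minus-as-+ : ∀ u v → u + - + 1 * v ≡ u - v
    minus-as-+ = solve-∀

  Q-nonvanishing : ∀ y → ∃ λ x₀ → ¬ Q y x₀ ≡ + 0 mod p
  Q-nonvanishing y = [ (λ Q0≡0 → - + 1 , Q0≡0⇒Q-1≢0 Q0≡0) , (λ Q0≢0 → + 0 , Q0≢0) ]′ (toSum (≡0? (Q y (+ 0))))
    where
    open ≡-mod-Reasoning p
    difference : ∀ u w v → w ≡ + 0 → (u - v) - (w - v) ≡ u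
    difference u _ v refl = cancel u v
      where
      cancel : ∀ u v → (u - v) - (+ 0 - v) ≡ u
      cancel = solve-∀
    Q0≡0⇒Q-1≢0 : Q y (+ 0) ≡ + 0 mod p → ¬ Q y (- + 1) ≡ + 0 mod p
    Q0≡0⇒Q-1≢0 Q0≡0 Q-1≡0 = 24≢0 (begin
      + 24                          ≡⟨ F1≡24 ⟨
      F (+ 1)                       ≡⟨ difference (F (+ 1)) (F (+ 0)) (+ 24 * + y) F0≡0 ⟨
      Q y (+ 0) - Q y (- + 1)       ≈⟨ minus-cong Q0≡0 Q-1≡0 ⟩
      + 0                           ∎)

  value-root : ∀ y r → (y ≡ᵇ value r) ≡ true → roots (Q y) r ≡ true
  value-root y r y≡value = ≡0⇒root (Q y) r (begin
    F (+ r + + 1) - + 24 * + y               ≡⟨ cong (λ t → F t - + 24 * + y) (ℤ.+-comm (+ r) (+ 1)) ⟩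
    F (+ suc r) - + 24 * + y                 ≡⟨ cong (_- + 24 * + y) (24*f≡F (suc r)) ⟨
    + 24 * f a b c (suc r) - + 24 * + y      ≈⟨ minus-cong (*-congˡ (+ 24) (res-≡mod (f a b c (suc r)))) mod-refl ⟨
    + 24 * + value r - + 24 * + y            ≡⟨ cong (λ t → + 24 * + t - + 24 * + y) (≡ᵇ-true⇒≡ {y} {value r} y≡value) ⟨
    + 24 * + y - + 24 * + y                  ≡⟨ ℤ.+-inverseʳ (+ 24 * + y) ⟩
    + 0                                      ∎)
    where open ≡-mod-Reasoning p

  fibre≤4 : ∀ y → count p (λ r → y ≡ᵇ value r) ≤ 4
  fibre≤4 y = let (x₀ , Qx₀≢0) = Q-nonvanishing y in
    ≤-trans (count-mono p (λ r _ → value-root y r)) (root-bound 4 (Q y) (Q-degree y) x₀ Qx₀≢0)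

  fibre≤4·V : ∀ y → count p (λ r → y ≡ᵇ value r) ≤ 4 ℕ.* 𝟙 (V y)
  fibre≤4·V y = bound (V y) refl
    where
    bound : ∀ b → V y ≡ b → count p (λ r → y ≡ᵇ value r) ≤ 4 ℕ.* 𝟙 b
    bound true  _   = fibre≤4 y
    bound false y∉V = ≤-reflexive (count-none p {λ r → y ≡ᵇ value r} λ r r<p → ¬true⇒false λ y≡value →
      contradiction (trans (sym (anyBelow-intro p (λ r → y ≡ᵇ value r) r<p y≡value)) y∉V) λ ())

  p≤4|V| : p ≤ 4 ℕ.* size V
  p≤4|V| = begin
    p                                           ≡⟨ count-all p {λ _ → true} (λ _ _ → refl) ⟨
    ∑ p (λ r → 1)                               ≡⟨ ∑-cong p (λ r _ → count-≡ᵇ p (res<p (f a b c (suc r)))) ⟨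
    ∑ p (λ r → count p (_≡ᵇ value r))           ≡⟨ ∑-swap p p (λ r y → 𝟙 (y ≡ᵇ value r)) ⟩
    ∑ p (λ y → count p (λ r → y ≡ᵇ value r))    ≤⟨ ∑-mono-≤ p (λ y _ → fibre≤4·V y) ⟩
    ∑ p (λ y → 4 ℕ.* 𝟙 (V y))                   ≡⟨ ∑-*ˡ p 4 (𝟙 ∘ V) ⟩
    4 ℕ.* size V                                ∎
    where open ℕ.≤-Reasoning

  nonsingular : ∃ λ a₀ → ¬ F′ (+ a₀) ≡ + 0 mod p
  nonsingular = pick (≡0? (F′ (+ 0))) (≡0? (F′ (+ 1))) (≡0? (F′ (+ 2))) (≡0? (F′ (+ 3)))
    where
    open ≡-mod-Reasoning p
    Singular : ℕ → Set
    Singular i = F′ (+ i) ≡ + 0 mod p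
    pick : Dec (Singular 0) → Dec (Singular 1) → Dec (Singular 2) → Dec (Singular 3) → ∃ λ a₀ → ¬ Singular a₀
    pick (no h)   _        _        _        = 0 , h
    pick (yes _)  (no h)   _        _        = 1 , h
    pick (yes _)  (yes _)  (no h)   _        = 2 , h
    pick (yes _)  (yes _)  (yes _)  (no h)   = 3 , h
    pick (yes e₀) (yes e₁) (yes e₂) (yes e₃) = ⊥-elim (≢0-* 24≢0 24≢0 (begin
      + 24 * + 24                                                    ≡⟨ cong (+ 24 *_) F1≡24 ⟨
      + 24 * F (+ 1)                                                 ≡⟨ F′-combination ⟨
      + 9 * F′ (+ 0) + + 19 * F′ (+ 1) - + 5 * F′ (+ 2) + F′ (+ 3)   ≈⟨ +-cong (minus-cong (+-cong (*-congˡ (+ 9) e₀) (*-congˡ (+ 19) e₁))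
                                                                                            (*-congˡ (+ 5) e₂)) e₃ ⟩
      + 0                                                            ∎))

  a₀ : ℕ
  a₀ = proj₁ nonsingular

  -- reps j consists of the residues of f a₀ + f (r₁ + 1) + … + f (rⱼ + 1) with all rᵢ < p.
  reps : ℕ → Subset
  reps zero    z = z ≡ᵇ res (f a b c a₀)
  reps (suc j) z = anyBelow p (λ r → reps j (res (+ z - f a b c (suc r))))

  reps-⊞ : ∀ j z → (reps j ⊞ V) z ≡ true → reps (suc j) z ≡ true
  reps-⊞ j z z∈reps⊞V =
    let (x , y , x<p , y<p , x∈reps , y∈V , x+y≡z) = ⊞-elim {reps j} {V} z∈reps⊞V
        (r , r<p , y≡value)                      = anyBelow-elim p (λ r → y ≡ᵇ value r) y∈V
        z-fr≡x : + z - f a b c (suc r) ≡ + x mod p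
        z-fr≡x = begin
          + z - f a b c (suc r)        ≈⟨ minus-cong x+y≡z (res-≡mod (f a b c (suc r))) ⟨
          + x + + y - + value r        ≡⟨ cong (λ t → + x + + y - + t) (≡ᵇ-true⇒≡ {y} {value r} y≡value) ⟨
          + x + + y - + y              ≡⟨ cancel (+ x) (+ y) ⟩
          + x                          ∎
    in  anyBelow-intro p _ r<p (subst (λ t → reps j t ≡ true) (sym (trans (res-cong z-fr≡x) (res-below x<p))) x∈reps)
    where
    open ≡-mod-Reasoning p
    cancel : ∀ x y → x + y - y ≡ x
    cancel = solve-∀

  size-reps₀ : size (reps 0) ≡ 1
  size-reps₀ = count-≡ᵇ p (res<p (f a b c a₀))

  2≤|V| : 2 ≤ size V
  2≤|V| = ℕ.≰⇒> λ |V|≤1 → <⇒≱ 4<p (≤-trans p≤4|V| (ℕ.*-monoʳ-≤ 4 |V|≤1))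

  w : ℕ
  w = ℕ.pred (size V)

  |V|≡1+w : size V ≡ suc w
  |V|≡1+w = sym (ℕ.suc-pred (size V) ⦃ ℕ.>-nonZero (≤-trans (s≤s z≤n) 2≤|V|) ⦄)

  p≤1+j*w : ∀ j → 16 ≤ j → p ≤ 1 ℕ.+ j ℕ.* w
  p≤1+j*w j 16≤j = begin
    p                        ≤⟨ p≤4|V| ⟩
    4 ℕ.* size V             ≡⟨ cong (4 ℕ.*_) |V|≡1+w ⟩
    4 ℕ.* suc w              ≤⟨ ℕ.*-monoʳ-≤ 4 (ℕ.+-monoˡ-≤ w 1≤w) ⟩
    4 ℕ.* (w ℕ.+ w)          ≡⟨ double w ⟩
    8 ℕ.* w                  ≤⟨ ℕ.*-monoˡ-≤ w (≤-trans (ℕ.m≤m+n 8 8) 16≤j) ⟩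
    j ℕ.* w                  ≤⟨ ℕ.n≤1+n _ ⟩
    1 ℕ.+ j ℕ.* w            ∎
    where
    open ℕ.≤-Reasoning
    1≤w : 1 ≤ w
    1≤w = ℕ.≤-pred (subst (2 ≤_) |V|≡1+w 2≤|V|)
    double : ∀ w → 4 ℕ.* (w ℕ.+ w) ≡ 8 ℕ.* w
    double = solve-∀ℕ

  reps-full : ∀ j → 16 ≤ j → ∀ z → z < p → reps j z ≡ true
  reps-full j 16≤j = count-full p (reps j) (large (chain-growth reps V |V|≡1+w reps-⊞-⊆ 0<|reps₀| j))
    where
    reps-⊞-⊆ : ∀ j → size (reps j ⊞ V) ≤ size (reps (suc j))
    reps-⊞-⊆ j = count-mono p (λ z _ → reps-⊞ j z)
    0<|reps₀| : 0 < size (reps 0)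
    0<|reps₀| = subst (0 <_) (sym size-reps₀) z<s
    large : p ≤ size (reps j) ⊎ size (reps 0) ℕ.+ j ℕ.* w ≤ size (reps j) → p ≤ size (reps j)
    large (inj₁ p≤|repsⱼ|)   = p≤|repsⱼ|
    large (inj₂ 1+jw≤|repsⱼ|) =
      ≤-trans (p≤1+j*w j 16≤j) (subst (λ n → n ℕ.+ j ℕ.* w ≤ size (reps j)) size-reps₀ 1+jw≤|repsⱼ|)

  reps-resp : ∀ j {m m′} → m ≡ m′ mod p → reps j (res m) ≡ true → reps j (res m′) ≡ true
  reps-resp j m≡m′ = subst (λ t → reps j t ≡ true) (res-cong m≡m′)

  reps-zero : ∀ {m} → reps 0 (res m) ≡ true → m ≡ f a b c a₀ mod p
  reps-zero {m} m∈reps₀ = res-injective (≡ᵇ-true⇒≡ {res m} {res (f a b c a₀)} m∈reps₀)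

  reps-suc : ∀ j {m} → reps (suc j) (res m) ≡ true → ∃ λ r → r < p × reps j (res (m - f a b c (suc r))) ≡ true
  reps-suc j {m} m∈reps =
    let (r , r<p , h) = anyBelow-elim p (λ r → reps j (res (+ res m - f a b c (suc r)))) m∈reps
    in  r , r<p , reps-resp j (minus-cong (res-≡mod m) (mod-refl {a = f a b c (suc r)})) h

  f-periodic : ∀ t r → f a b c (suc (t ℕ.* p ℕ.+ r)) ≡ f a b c (suc r) mod p
  f-periodic t r = *-cancelˡ-mod 24≢0 (begin
    + 24 * f a b c (suc (t ℕ.* p ℕ.+ r))   ≡⟨ 24*f≡F (suc (t ℕ.* p ℕ.+ r)) ⟩
    F (+ suc (t ℕ.* p ℕ.+ r))              ≈⟨ Degree≤-resp-mod 4 F-degree (modulo (divides (+ t) shift)) ⟩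
    F (+ suc r)                            ≡⟨ 24*f≡F (suc r) ⟨
    + 24 * f a b c (suc r)                 ∎)
    where
    open ≡-mod-Reasoning p
    cancel : ∀ t p r → + 1 + (t * p + r) - (+ 1 + r) ≡ t * p
    cancel = solve-∀
    shift : + suc (t ℕ.* p ℕ.+ r) - + suc r ≡ + t * + p
    shift = trans (cong (λ n → + 1 + n - + suc r) (trans (ℤ.pos-+ (t ℕ.* p) r) (cong (_+ + r) (ℤ.pos-* t p))))
                  (cancel (+ t) (+ p) (+ r))

  module _ (k′ : ℕ) where

    q : ℕ
    q = p ^ suc k′

    instance
      q≢0 : ℕ.NonZero q
      q≢0 = ℕ.m^n≢0 p (suc k′)

    open Hensel F F′ K taylor (Degree≤-resp-mod 3 F′-degree)

    solution-below-q : ∀ {m} → m ≡ f a b c a₀ mod p → ∃ λ i → i < q × f a b c (suc i) ≡ m mod q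
    solution-below-q {m} m≡fa₀ =
      let (n , _ , Fn≡24m)      = hensel k′ {+ 24 * m} {+ a₀} Fa₀≡24m (proj₂ nonsingular)
          (i , i<q , n≡1+i)     = Residues.≡suc-below q n
      in  i , i<q , *-cancelˡ-mod-^ (suc k′) 24≢0 (begin
            + 24 * f a b c (suc i)  ≡⟨ 24*f≡F (suc i) ⟩
            F (+ suc i)             ≈⟨ Degree≤-resp-mod 4 F-degree n≡1+i ⟨
            F n                     ≈⟨ Fn≡24m ⟩
            + 24 * m                ∎)
      where
      open ≡-mod-Reasoning q
      Fa₀≡24m : F (+ a₀) ≡ + 24 * m mod p
      Fa₀≡24m = mod-trans (mod-reflexive (sym (24*f≡F a₀))) (*-congˡ (+ 24) (mod-sym m≡fa₀))

    -- The last coordinate comes from Hensel lifting at a₀; every other coordinate may be moved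
    -- within its residue class mod p, since f is periodic mod p, which gives p ^ k′ choices each.
    count-solutions : ∀ j m → reps j (res m) ≡ true → (p ^ k′) ^ j ≤ M a b c (suc j) m q
    count-solutions zero m m∈reps₀ =
      let (i , i<q , fi≡m) = solution-below-q (reps-zero m∈reps₀)
      in  begin
        1                                                  ≤⟨ M-zero a b c q (∣⇒∣ᵤ (subst (+ q ∣_) (flip (f a b c (suc i)) m) (∣-diff fi≡m))) ⟩
        M a b c 0 (m - f a b c (suc i)) q                  ≤⟨ term≤∑ q (λ i → M a b c 0 (m - f a b c (suc i)) q) i<q ⟩
        ∑ q (λ i → M a b c 0 (m - f a b c (suc i)) q)      ≤⟨ M-suc a b c q 0 m ⟩
        M a b c 1 m q                                      ∎
      where
      open ℕ.≤-Reasoning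
      flip : ∀ x m → x - m ≡ + 0 - (m - x)
      flip = solve-∀
    count-solutions (suc j) m m∈reps =
      let (r , r<p , m-fr∈reps) = reps-suc j m∈reps
      in  begin
        (p ^ k′) ^ suc j                                                        ≡⟨ ∑-const (p ^ k′) ((p ^ k′) ^ j) ⟨
        ∑ (p ^ k′) (λ t → (p ^ k′) ^ j)                                         ≤⟨ ∑-mono-≤ (p ^ k′) (λ t _ →
                                                                                     count-solutions j _ (reps-resp j (shifted t r) m-fr∈reps)) ⟩
        ∑ (p ^ k′) (λ t → M a b c (suc j) (m - f a b c (suc (t ℕ.* p ℕ.+ r))) q) ≤⟨ ∑-subsample (p ^ k′) p (λ i → M a b c (suc j) (m - f a b c (suc i)) q) r<p ⟩
        ∑ (p ^ k′ ℕ.* p) (λ i → M a b c (suc j) (m - f a b c (suc i)) q)       ≡⟨ cong (λ n → ∑ n (λ i → M a b c (suc j) (m - f a b c (suc i)) q)) (ℕ.*-comm (p ^ k′) p) ⟩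
        ∑ q (λ i → M a b c (suc j) (m - f a b c (suc i)) q)                     ≤⟨ M-suc a b c q (suc j) m ⟩
        M a b c (suc (suc j)) m q                                               ∎
      where
      open ℕ.≤-Reasoning
      shifted : ∀ t r → m - f a b c (suc r) ≡ m - f a b c (suc (t ℕ.* p ℕ.+ r)) mod p
      shifted t r = minus-cong (mod-refl {a = m}) (mod-sym (f-periodic t r))

    solutions-lower-bound : ∀ j m → 16 ≤ j → (p ^ k′) ^ j ≤ M a b c (suc j) m q
    solutions-lower-bound j m 16≤j = count-solutions j m (reps-full j 16≤j (res m) (res<p m))

open import Data.Integer using (+_)
open import Data.Nat using (_≤_; _∸_; _*_; _^_; suc; s≤s)
open import Data.Nat.Properties using (^-*-assoc; ≤-trans; m≤m+n)
open import Relation.Binary.PropositionalEquality using (subst)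

corollary5p8 : (A B C : ℤ) → + 1 ℤ.≤ A → (m : ℤ) → (p k s : ℕ) → Prime p → 11 ≤ p → 2 ≤ k → 17 ≤ s → p ^ ((k ∸ 1) * (s ∸ 1)) ≤ M A B C s m (p ^ k)
corollary5p8 A B C _ m p (suc k′) (suc j) p-prime 11≤p (s≤s _) (s≤s 16≤j) =
  subst (_≤ M A B C (suc j) m (p ^ suc k′)) (^-*-assoc p k′ j)
        (QuarticWaring.solutions-lower-bound p p-prime (≤-trans (m≤m+n 5 6) 11≤p) A B C k′ j m 16≤j)
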